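{- Let $p$ be a prime, $\omega_1=e^{2\pi i/p}$, $F\in\mathbb Z[x]$, and $H(x)=\prod_{j=0}^{p-1}F(x\omega_1^j)$. Then $H(x)=g(x^p)$ for some $g\in\mathbb Z[x]$ with $g(x)\equiv F(x)\pmod p$ (coefficientwise), and $$N_i(F)=N_{i-1}(g)\ \text{ for all } i\geq 2,\qquad F(1)N_1(F)=g(1).$$ Moreover, if $p=3$ and $F(x)=f_0(x^3)+xf_1(x^3)+x^2f_2(x^3)$ with $f_0,f_1,f_2\in\mathbb Z[x]$, then $$g(x)=f_0(x)^3+xf_1(x)^3+x^2f_2(x)^3-3xf_0(x)f_1(x)f_2(x).$$
   Context: For $k\geq 1$, $\omega_k=e^{2\pi i/p^k}$ and for $G\in\mathbb Z[x]$, $N_k(G)=\prod_{1\le j\le p^k,\ p\nmid j}G(\omega_k^j)$. -}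

module Defs where

open import Level using (Level)
open import Algebra.Bundles using (CommutativeRing)
open import Data.Nat as ℕ using (ℕ; zero; suc; _<_)
open import Data.Nat.Divisibility using (_∣?_)
open import Data.Integer as ℤ using (ℤ; +_; -[1+_])
open import Data.Integer.Properties using (+-*-commutativeRing)
open import Data.List using (List; []; _∷_; replicate; _++_; map)
open import Data.Bool using (if_then_else_)
open import Data.Sum using (_⊎_)
open import Data.Product using (_×_)
open import Relation.Nullary using (¬_; does)
open import Relation.Binary.PropositionalEquality using (_≡_)

-- Univariate polynomials over a commutative ring, as coefficient lists
-- (lowest degree first).  Polynomial equality is coefficientwise (_≈ₚ_),
-- so trailing zeros are irrelevant.
module PolyOps {c ℓ : Level} (R : CommutativeRing c ℓ) where
  open CommutativeRing R

  Poly : Set c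
  Poly = List Carrier

  coeff : Poly → ℕ → Carrier
  coeff []       _       = 0#
  coeff (a ∷ _)  zero    = a
  coeff (_ ∷ as) (suc i) = coeff as i

  _≈ₚ_ : Poly → Poly → Set ℓ
  P ≈ₚ Q = ∀ i → coeff P i ≈ coeff Q i

  infixl 6 _⊕_
  infixl 7 _⊗_

  _⊕_ : Poly → Poly → Poly
  []       ⊕ q        = q
  (a ∷ p)  ⊕ []       = a ∷ p
  (a ∷ p)  ⊕ (b ∷ q)  = (a + b) ∷ (p ⊕ q)

  scale : Carrier → Poly → Poly
  scale c = map (c *_)

  neg : Poly → Poly
  neg = map (-_)

  _⊗_ : Poly → Poly → Poly
  []      ⊗ q = []
  (a ∷ p) ⊗ q = scale a q ⊕ (0# ∷ (p ⊗ q))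

  X : Poly
  X = 0# ∷ 1# ∷ []

  const : Carrier → Poly
  const a = a ∷ []

  pow : Carrier → ℕ → Carrier
  pow a zero    = 1#
  pow a (suc n) = a * pow a n

  powₚ : Poly → ℕ → Poly
  powₚ P zero    = const 1#
  powₚ P (suc n) = P ⊗ powₚ P n

  eval : Poly → Carrier → Carrier
  eval []       x = 0#
  eval (a ∷ as) x = a + x * eval as x

  -- P(x) ↦ P(x^n)  (insert n-1 zeros between coefficients), for n ≥ 1
  subPow : ℕ → Poly → Poly
  subPow zero    P        = P   -- not used (n ≥ 1 always)
  subPow (suc n) []       = []
  subPow (suc n) (a ∷ as) = a ∷ (replicate n 0# ++ subPow (suc n) as)

  -- P(x) ↦ P(c·x)
  twistFrom : Carrier → Carrier → Poly → Poly
  twistFrom c acc []       = []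
  twistFrom c acc (a ∷ as) = (acc * a) ∷ twistFrom c (acc * c) as

  twist : Carrier → Poly → Poly
  twist c = twistFrom c 1#

  prodₚ : ℕ → (ℕ → Poly) → Poly
  prodₚ zero    f = const 1#
  prodₚ (suc n) f = f n ⊗ prodₚ n f

  prodCoprime : ℕ → ℕ → (ℕ → Carrier) → Carrier
  prodCoprime p zero    f = 1#
  prodCoprime p (suc n) f =
    if does (p ∣? suc n) then prodCoprime p n f else f (suc n) * prodCoprime p n f

ℤring : CommutativeRing _ _
ℤring = +-*-commutativeRing

ℤPoly : Set
ℤPoly = PolyOps.Poly ℤring

module Cast {c ℓ : Level} (R : CommutativeRing c ℓ) where
  open CommutativeRing R

  natCast : ℕ → Carrier
  natCast zero    = 0#
  natCast (suc n) = 1# + natCast n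

  ι : ℤ → Carrier
  ι (+ n)      = natCast n
  ι -[1+ n ]   = - natCast (suc n)

  ιₚ : ℤPoly → PolyOps.Poly R
  ιₚ = map ι

  record IsChar0Domain : Set (c Level.⊔ ℓ) where
    field
      char0      : ∀ (n : ℤ) → ι n ≈ 0# → n ≡ + 0
      noZeroDivs : ∀ a b → a * b ≈ 0# → (a ≈ 0#) ⊎ (b ≈ 0#)

  IsPrimitiveRoot : ℕ → Carrier → Set ℓ
  IsPrimitiveRoot n ζ =
    PolyOps.pow R ζ n ≈ 1# × (∀ m → 0 < m → m < n → ¬ (PolyOps.pow R ζ m ≈ 1#))

  -- N_k(G) = ∏_{1 ≤ j ≤ p^k, p ∤ j} G(ω_k^j), computed with the given root ω_k
  N : ℕ → (ℕ → Carrier) → ℕ → ℤPoly → Carrier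
  N p ω k G =
    PolyOps.prodCoprime R p (p ℕ.^ k)
      (λ j → PolyOps.eval R (ιₚ G) (PolyOps.pow R (ω k) j))

module ℤP = PolyOps ℤring

{-# OPTIONS --safe #-}
-- Let cₘ(T) be the coefficients of the polynomial ∏_{j<p} F(Tʲx) over ℤ[T]. For p ∤ k the substitution
-- T ↦ ωᵏ only permutes the factors of H(x) = ∏_j F(ωʲx), so cₘ(ωᵏ) is the coefficient hₘ of H for every
-- k prime to p. Summing ω^{kw}cₘ(ωᵏ) over k < p for w = 0 and w = p - 1 (orthogonality of the p-th roots
-- of unity) then writes p·hₘ as p times an integer, and H(ωx) = H(x) forces hₘ = 0 for p ∤ m; hence
-- H(x) = g(xᵖ) with g ∈ ℤ[x]. The same sum for w = 0 compares g with cₘ(1), the coefficients of F(x)ᵖ,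
-- and the Frobenius congruence F(x)ᵖ ≡ F(xᵖ) (mod p) gives g ≡ F. For the norms, the residues prime to p
-- modulo pⁱ fall into p blocks indexed by the p-th roots of unity, and multiplying out each block of F(ζᵘ)
-- gives the value g(ζ^{pu}), where ζ is a primitive pⁱ-th root of unity and ζᵖ a primitive p^{i-1}-th one.
-- For p = 3 the three conjugate factors multiply to the cubic norm form A³ + u³ + v³ − 3Auv.
module Submission where

open import Defs
open import Level using (_⊔_)
open import Algebra.Bundles using (CommutativeRing)
open import Algebra.Solver.Ring.AlmostCommutativeRing using (fromCommutativeRing; _-Raw-AlmostCommutative⟶_)
open import Data.Nat as ℕ using (ℕ; zero; suc; _≤_; _<_; _∸_; z≤n; s≤s; NonZero)
import Data.Nat.Properties as ℕ
import Data.Nat.Divisibility as ℕ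
open import Data.Nat.Divisibility
  using (divides; quotient; _∣?_; _∣0; ∣-refl; ∣-trans; 1∣_; >⇒∤; m∣m*n; ∣n⇒∣m*n; ∣m∣n⇒∣m+n; ∣m+n∣m⇒∣n; ∣n∣m%n⇒∣m; m%n≡0⇒n∣m
        ; *-monoʳ-∣; *-cancelˡ-∣)
open import Data.Nat.DivMod using (_%_; _/_; m≡m%n+[m/n]*n; m%n<n)
open import Data.Nat.Primality using (Prime; euclidsLemma; prime⇒nonZero; ¬prime[0]; ¬prime[1])
open import Data.Nat.Combinatorics using (_C_; nCk+nC[k+1]≡[n+1]C[k+1]; nC1≡n; nCn≡1)
open import Data.Integer as ℤ using (ℤ; +_; -[1+_])
import Data.Integer.Properties as ℤ
open import Data.Integer.Divisibility using (_∣_)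
open import Data.Integer.Tactic.RingSolver using (solve-∀)
open import Data.Sign as Sign using (Sign)
open import Data.Fin as Fin using (Fin; toℕ; inject₁; fromℕ)
import Data.Fin.Properties as Fin
open import Data.List using (List; []; _∷_; map; replicate; _++_; length; foldr; applyUpTo)
import Data.List.Properties as List
open import Data.List.Relation.Unary.All using (All; []; _∷_)
open import Data.List.Relation.Unary.Any using (Any; here; there)
open import Data.List.Relation.Unary.AllPairs using (AllPairs; []; _∷_)
open import Data.List.Relation.Unary.Unique.Propositional using (Unique)
open import Data.List.Membership.Propositional using (_∈_)
open import Data.Maybe using (Maybe; just; nothing)
open import Data.Bool using (if_then_else_)
open import Data.Empty using (⊥-elim)
open import Data.Sum using (inj₁; inj₂; [_,_]′)
open import Data.Product using (Σ; _×_; _,_; proj₁; proj₂)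
open import Function using (_∘_; id)
open import Relation.Nullary using (¬_; Dec; yes; no; does)
open import Relation.Binary.Definitions using (tri<; tri≈; tri>)
open import Relation.Binary.PropositionalEquality as ≡ using (_≡_; _≢_)

-- Elementary number theory

prime⇒1<p : ∀ {p} → Prime p → 1 < p
prime⇒1<p {zero}        pr = ⊥-elim (¬prime[0] pr)
prime⇒1<p {suc zero}    pr = ⊥-elim (¬prime[1] pr)
prime⇒1<p {suc (suc _)} _  = s≤s (s≤s z≤n)

%≡%⇒∣∸ : ∀ M .{{_ : NonZero M}} {a b} → a ≤ b → a % M ≡ b % M → M ℕ.∣ b ℕ.∸ a
%≡%⇒∣∸ M {a} {b} a≤b a≡b = divides (b / M ℕ.∸ a / M) (begin
    b ℕ.∸ a                                                ≡⟨ ≡.cong₂ ℕ._∸_ (m≡m%n+[m/n]*n b M) (m≡m%n+[m/n]*n a M) ⟩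
    (b % M ℕ.+ b / M ℕ.* M) ℕ.∸ (a % M ℕ.+ a / M ℕ.* M)    ≡⟨ ≡.cong (λ r → (b % M ℕ.+ b / M ℕ.* M) ℕ.∸ (r ℕ.+ a / M ℕ.* M)) a≡b ⟩
    (b % M ℕ.+ b / M ℕ.* M) ℕ.∸ (b % M ℕ.+ a / M ℕ.* M)    ≡⟨ ℕ.[m+n]∸[m+o]≡n∸o (b % M) _ _ ⟩
    b / M ℕ.* M ℕ.∸ a / M ℕ.* M                            ≡⟨ ℕ.*-distribʳ-∸ M (b / M) (a / M) ⟨
    (b / M ℕ.∸ a / M) ℕ.* M                                ∎)
  where open ≡.≡-Reasoning

∣∧<⇒≡0 : ∀ {M d} → M ℕ.∣ d → d < M → d ≡ 0
∣∧<⇒≡0 {d = zero}  _   _   = ≡.refl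
∣∧<⇒≡0 {d = suc d} M∣d d<M = ⊥-elim (>⇒∤ d<M M∣d)

UnitMod : ℕ → ℕ → Set
UnitMod M k = ∀ d → M ℕ.∣ k ℕ.* d → M ℕ.∣ d

unitMod-1 : ∀ M → UnitMod M 1
unitMod-1 M d M∣1*d = ≡.subst (M ℕ.∣_) (ℕ.*-identityˡ d) M∣1*d

prime⇒unitMod : ∀ {p k} → Prime p → ¬ p ℕ.∣ k → UnitMod p k
prime⇒unitMod {k = k} pr p∤k d p∣kd with euclidsLemma k d pr p∣kd
... | inj₁ p∣k = ⊥-elim (p∤k p∣k)
... | inj₂ p∣d = p∣d

prime⇒unitMod-^ : ∀ {p k} → Prime p → ¬ p ℕ.∣ k → ∀ e → UnitMod (p ℕ.^ e) k
prime⇒unitMod-^ _ _ zero d _ = 1∣ d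
prime⇒unitMod-^ {p} {k} pr p∤k (suc e) d pᵉ⁺¹∣kd with prime⇒unitMod pr p∤k d (∣-trans (m∣m*n (p ℕ.^ e)) pᵉ⁺¹∣kd)
... | divides q ≡.refl =
  ≡.subst (p ℕ.* p ℕ.^ e ℕ.∣_) (ℕ.*-comm p q)
    (*-monoʳ-∣ p (prime⇒unitMod-^ pr p∤k e q (*-cancelˡ-∣ p {{prime⇒nonZero pr}} pᵉ⁺¹∣pkq)))
  where
  pᵉ⁺¹∣pkq : p ℕ.* p ℕ.^ e ℕ.∣ p ℕ.* (k ℕ.* q)
  pᵉ⁺¹∣pkq = ≡.subst (p ℕ.* p ℕ.^ e ℕ.∣_) (≡.trans (≡.sym (ℕ.*-assoc k q p)) (ℕ.*-comm (k ℕ.* q) p)) pᵉ⁺¹∣kd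

affine-%-injective : ∀ M .{{_ : NonZero M}} c k → UnitMod M k →
                     ∀ {i j} → i < M → j < M → (c ℕ.+ k ℕ.* i) % M ≡ (c ℕ.+ k ℕ.* j) % M → i ≡ j
affine-%-injective M c k unit {i} {j} i<M j<M eq =
  [ (λ i≤j → ordered i≤j j<M eq) , (λ j≤i → ≡.sym (ordered j≤i i<M (≡.sym eq))) ]′ (ℕ.≤-total i j)
  where
  ordered : ∀ {i j} → i ≤ j → j < M → (c ℕ.+ k ℕ.* i) % M ≡ (c ℕ.+ k ℕ.* j) % M → i ≡ j
  ordered {i} {j} i≤j j<M eq =
    ℕ.≤-antisym i≤j (ℕ.m∸n≡0⇒m≤n (∣∧<⇒≡0 (unit (j ℕ.∸ i) M∣k[j∸i]) (ℕ.≤-trans (s≤s (ℕ.m∸n≤m j i)) j<M)))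
    where
    M∣k[j∸i] : M ℕ.∣ k ℕ.* (j ℕ.∸ i)
    M∣k[j∸i] = ≡.subst (M ℕ.∣_) (≡.trans (ℕ.[m+n]∸[m+o]≡n∸o c _ _) (≡.sym (ℕ.*-distribˡ-∸ k j i)))
                 (%≡%⇒∣∸ M (ℕ.+-monoʳ-≤ c (ℕ.*-monoʳ-≤ k i≤j)) eq)

-- The canonical map ℤ → R

module IntCast {c ℓ} (R : CommutativeRing c ℓ) where
  open CommutativeRing R
  open Cast R
  open import Algebra.Properties.Ring ring using (-1*x≈-x; -‿involutive)
  open import Algebra.Properties.Group +-group using (ε⁻¹≈ε)
  open import Algebra.Properties.AbelianGroup +-abelianGroup using (⁻¹-∙-comm)
  open import Algebra.Properties.CommutativeSemigroup *-commutativeSemigroup using (interchange)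
  open import Relation.Binary.Reasoning.Setoid setoid

  natCast-+ : ∀ m n → natCast (m ℕ.+ n) ≈ natCast m + natCast n
  natCast-+ zero    n = sym (+-identityˡ _)
  natCast-+ (suc m) n = trans (+-congˡ (natCast-+ m n)) (sym (+-assoc _ _ _))

  natCast-* : ∀ m n → natCast (m ℕ.* n) ≈ natCast m * natCast n
  natCast-* zero    n = sym (zeroˡ _)
  natCast-* (suc m) n = begin
    natCast (n ℕ.+ m ℕ.* n)                 ≈⟨ natCast-+ n (m ℕ.* n) ⟩
    natCast n + natCast (m ℕ.* n)           ≈⟨ +-cong (sym (*-identityˡ _)) (natCast-* m n) ⟩
    1# * natCast n + natCast m * natCast n  ≈⟨ distribʳ _ _ _ ⟨
    (1# + natCast m) * natCast n            ∎

  ι-1 : ι (+ 1) ≈ 1#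
  ι-1 = +-identityʳ 1#

  ι-neg : ∀ z → ι (ℤ.- z) ≈ - ι z
  ι-neg (+ zero)  = sym ε⁻¹≈ε
  ι-neg (+ suc n) = refl
  ι-neg -[1+ n ]  = sym (-‿involutive _)

  ι-⊖ : ∀ m n → ι (m ℤ.⊖ n) ≈ natCast m - natCast n
  ι-⊖ zero    zero    = sym (-‿inverseʳ _)
  ι-⊖ zero    (suc n) = sym (+-identityˡ _)
  ι-⊖ (suc m) zero    = sym (trans (+-congˡ ε⁻¹≈ε) (+-identityʳ _))
  ι-⊖ (suc m) (suc n) = begin
    ι (suc m ℤ.⊖ suc n)                       ≡⟨ ≡.cong ι (ℤ.[1+m]⊖[1+n]≡m⊖n m n) ⟩
    ι (m ℤ.⊖ n)                               ≈⟨ ι-⊖ m n ⟩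
    natCast m - natCast n                     ≈⟨ cancel-1 ⟨
    (1# + natCast m) - (1# + natCast n)       ∎
    where
    cancel-1 : (1# + natCast m) - (1# + natCast n) ≈ natCast m - natCast n
    cancel-1 = begin
      (1# + natCast m) + - (1# + natCast n)   ≈⟨ +-congˡ (⁻¹-∙-comm _ _) ⟨
      (1# + natCast m) + (- 1# + - natCast n) ≈⟨ +-congʳ (+-comm _ _) ⟩
      (natCast m + 1#) + (- 1# + - natCast n) ≈⟨ +-assoc _ _ _ ⟩
      natCast m + (1# + (- 1# + - natCast n)) ≈⟨ +-congˡ (+-assoc _ _ _) ⟨
      natCast m + ((1# - 1#) + - natCast n)   ≈⟨ +-congˡ (+-congʳ (-‿inverseʳ _)) ⟩
      natCast m + (0# + - natCast n)          ≈⟨ +-congˡ (+-identityˡ _) ⟩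
      natCast m - natCast n                   ∎

  ι-+ : ∀ a b → ι (a ℤ.+ b) ≈ ι a + ι b
  ι-+ (+ m)    (+ n)    = natCast-+ m n
  ι-+ (+ m)    -[1+ n ] = ι-⊖ m (suc n)
  ι-+ -[1+ m ] (+ n)    = trans (ι-⊖ n (suc m)) (+-comm _ _)
  ι-+ -[1+ m ] -[1+ n ] = begin
    - natCast (suc (suc (m ℕ.+ n)))           ≡⟨ ≡.cong (λ k → - natCast (suc k)) (≡.sym (ℕ.+-suc m n)) ⟩
    - natCast (suc m ℕ.+ suc n)               ≈⟨ -‿cong (natCast-+ (suc m) (suc n)) ⟩
    - (natCast (suc m) + natCast (suc n))     ≈⟨ ⁻¹-∙-comm _ _ ⟨
    - natCast (suc m) + - natCast (suc n)     ∎

  private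
    signCast : Sign → Carrier
    signCast Sign.+ = 1#
    signCast Sign.- = - 1#

    signCast-* : ∀ s t → signCast (s Sign.* t) ≈ signCast s * signCast t
    signCast-* Sign.+ Sign.+ = sym (*-identityˡ _)
    signCast-* Sign.+ Sign.- = sym (*-identityˡ _)
    signCast-* Sign.- Sign.+ = sym (*-identityʳ _)
    signCast-* Sign.- Sign.- = sym (trans (-1*x≈-x _) (-‿involutive _))

    ι-◃ : ∀ s n → ι (s ℤ.◃ n) ≈ signCast s * natCast n
    ι-◃ s       zero    = sym (zeroʳ _)
    ι-◃ Sign.+ (suc n) = sym (*-identityˡ _)
    ι-◃ Sign.- (suc n) = sym (-1*x≈-x _)

    ι-sign-abs : ∀ z → ι z ≈ signCast (ℤ.sign z) * natCast ℤ.∣ z ∣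
    ι-sign-abs (+ n)    = sym (*-identityˡ _)
    ι-sign-abs -[1+ n ] = sym (-1*x≈-x _)

  ι-* : ∀ a b → ι (a ℤ.* b) ≈ ι a * ι b
  ι-* a b = begin
    ι (ℤ.sign a Sign.* ℤ.sign b ℤ.◃ ℤ.∣ a ∣ ℕ.* ℤ.∣ b ∣)
      ≈⟨ ι-◃ (ℤ.sign a Sign.* ℤ.sign b) (ℤ.∣ a ∣ ℕ.* ℤ.∣ b ∣) ⟩
    signCast (ℤ.sign a Sign.* ℤ.sign b) * natCast (ℤ.∣ a ∣ ℕ.* ℤ.∣ b ∣)
      ≈⟨ *-cong (signCast-* (ℤ.sign a) (ℤ.sign b)) (natCast-* ℤ.∣ a ∣ ℤ.∣ b ∣) ⟩
    (signCast (ℤ.sign a) * signCast (ℤ.sign b)) * (natCast ℤ.∣ a ∣ * natCast ℤ.∣ b ∣)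
      ≈⟨ interchange _ _ _ _ ⟩
    (signCast (ℤ.sign a) * natCast ℤ.∣ a ∣) * (signCast (ℤ.sign b) * natCast ℤ.∣ b ∣)
      ≈⟨ *-cong (ι-sign-abs a) (ι-sign-abs b) ⟨
    ι a * ι b ∎

  ι-homomorphism : ℤ.+-*-rawRing -Raw-AlmostCommutative⟶ fromCommutativeRing R
  ι-homomorphism = record
    { ⟦_⟧ = ι ; +-homo = ι-+ ; *-homo = ι-* ; -‿homo = ι-neg ; 0-homo = refl ; 1-homo = ι-1 }

  private
    ι-≟ : ∀ m n → Maybe (ι m ≈ ι n)
    ι-≟ m n with m ℤ.≟ n
    ... | yes ≡.refl = just refl
    ... | no _       = nothing

  open import Algebra.Solver.Ring ℤ.+-*-rawRing (fromCommutativeRing R) ι-homomorphism ι-≟ public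
    using (solve; _:=_; _:+_; _:*_; :-_; _:-_; con)

-- Finite sums and products, powers, evaluation of polynomials

module RingLemmas {c ℓ} (R : CommutativeRing c ℓ) where
  open CommutativeRing R
  open PolyOps R
  open Cast R
  open IntCast R
  open import Relation.Binary.Reasoning.Setoid setoid

  ∏ : ℕ → (ℕ → Carrier) → Carrier
  ∏ zero    h = 1#
  ∏ (suc n) h = h n * ∏ n h

  ∑ : ℕ → (ℕ → Carrier) → Carrier
  ∑ zero    h = 0#
  ∑ (suc n) h = h n + ∑ n h

  ∏-cong : ∀ n {h k} → (∀ j → h j ≈ k j) → ∏ n h ≈ ∏ n k
  ∏-cong zero    h≈k = refl
  ∏-cong (suc n) h≈k = *-cong (h≈k n) (∏-cong n h≈k)

  ∑-cong : ∀ n {h k} → (∀ j → j < n → h j ≈ k j) → ∑ n h ≈ ∑ n k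
  ∑-cong zero    h≈k = refl
  ∑-cong (suc n) h≈k = +-cong (h≈k n ℕ.≤-refl) (∑-cong n (λ j j<n → h≈k j (ℕ.m<n⇒m<1+n j<n)))

  ∏-* : ∀ n (h k : ℕ → Carrier) → ∏ n (λ j → h j * k j) ≈ ∏ n h * ∏ n k
  ∏-* zero    h k = sym (*-identityˡ _)
  ∏-* (suc n) h k = trans (*-congˡ (∏-* n h k))
    (solve 4 (λ a b c d → (a :* b) :* (c :* d) := (a :* c) :* (b :* d)) refl (h n) (k n) _ _)

  ∏-1 : ∀ n → ∏ n (λ _ → 1#) ≈ 1#
  ∏-1 zero    = refl
  ∏-1 (suc n) = trans (*-identityˡ _) (∏-1 n)

  ∏-first : ∀ n (h : ℕ → Carrier) → ∏ (suc n) h ≈ h 0 * ∏ n (h ∘ suc)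
  ∏-first zero    h = refl
  ∏-first (suc n) h = trans (*-congˡ (∏-first n h)) (solve 3 (λ a b c → a :* (b :* c) := b :* (a :* c)) refl _ _ _)

  ∑-first : ∀ n (h : ℕ → Carrier) → ∑ (suc n) h ≈ h 0 + ∑ n (h ∘ suc)
  ∑-first zero    h = refl
  ∑-first (suc n) h = trans (+-congˡ (∑-first n h)) (solve 3 (λ a b c → a :+ (b :+ c) := b :+ (a :+ c)) refl _ _ _)

  ∑-0 : ∀ n → ∑ n (λ _ → 0#) ≈ 0#
  ∑-0 zero    = refl
  ∑-0 (suc n) = trans (+-identityˡ _) (∑-0 n)

  ∑-1 : ∀ n → ∑ n (λ _ → 1#) ≈ natCast n
  ∑-1 zero    = refl
  ∑-1 (suc n) = +-congˡ (∑-1 n)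

  ∑-+ : ∀ n (h k : ℕ → Carrier) → ∑ n (λ j → h j + k j) ≈ ∑ n h + ∑ n k
  ∑-+ zero    h k = sym (+-identityˡ _)
  ∑-+ (suc n) h k = trans (+-congˡ (∑-+ n h k))
    (solve 4 (λ a b c d → (a :+ b) :+ (c :+ d) := (a :+ c) :+ (b :+ d)) refl (h n) (k n) _ _)

  ∑-*ˡ : ∀ n a (h : ℕ → Carrier) → ∑ n (λ j → a * h j) ≈ a * ∑ n h
  ∑-*ˡ zero    a h = sym (zeroʳ _)
  ∑-*ˡ (suc n) a h = trans (+-congˡ (∑-*ˡ n a h)) (sym (distribˡ _ _ _))

  ∑-*ʳ : ∀ n a (h : ℕ → Carrier) → ∑ n (λ j → h j * a) ≈ ∑ n h * a
  ∑-*ʳ zero    a h = sym (zeroˡ _)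
  ∑-*ʳ (suc n) a h = trans (+-congˡ (∑-*ʳ n a h)) (sym (distribʳ _ _ _))

  pow-cong : ∀ {a b} n → a ≈ b → pow a n ≈ pow b n
  pow-cong zero    a≈b = refl
  pow-cong (suc n) a≈b = *-cong a≈b (pow-cong n a≈b)

  pow-+ : ∀ a m n → pow a (m ℕ.+ n) ≈ pow a m * pow a n
  pow-+ a zero    n = sym (*-identityˡ _)
  pow-+ a (suc m) n = trans (*-congˡ (pow-+ a m n)) (sym (*-assoc _ _ _))

  pow-pow : ∀ a m n → pow a (n ℕ.* m) ≈ pow (pow a m) n
  pow-pow a m zero    = refl
  pow-pow a m (suc n) = trans (pow-+ a m (n ℕ.* m)) (*-congˡ (pow-pow a m n))

  pow-* : ∀ a b n → pow (a * b) n ≈ pow a n * pow b n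
  pow-* a b zero    = sym (*-identityˡ _)
  pow-* a b (suc n) = trans (*-congˡ (pow-* a b n))
    (solve 4 (λ a b x y → (a :* b) :* (x :* y) := (a :* x) :* (b :* y)) refl a b (pow a n) (pow b n))

  pow-1# : ∀ n → pow 1# n ≈ 1#
  pow-1# zero    = refl
  pow-1# (suc n) = trans (*-identityˡ _) (pow-1# n)

  pow-comm : ∀ a m n → pow (pow a m) n ≈ pow (pow a n) m
  pow-comm a m n = trans (sym (pow-pow a m n)) (trans (reflexive (≡.cong (pow a) (ℕ.*-comm n m))) (pow-pow a n m))

  pow-% : ∀ α N .{{_ : NonZero N}} → pow α N ≈ 1# → ∀ k → pow α k ≈ pow α (k % N)
  pow-% α N αᴺ≈1 k = begin
    pow α k                                 ≡⟨ ≡.cong (pow α) (m≡m%n+[m/n]*n k N) ⟩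
    pow α (k % N ℕ.+ (k / N) ℕ.* N)         ≈⟨ pow-+ α (k % N) _ ⟩
    pow α (k % N) * pow α ((k / N) ℕ.* N)   ≈⟨ *-congˡ (trans (pow-pow α N (k / N)) (trans (pow-cong (k / N) αᴺ≈1) (pow-1# (k / N)))) ⟩
    pow α (k % N) * 1#                      ≈⟨ *-identityʳ _ ⟩
    pow α (k % N)                           ∎

  pow-multiple : ∀ α N → pow α N ≈ 1# → ∀ q → pow α (q ℕ.* N) ≈ 1#
  pow-multiple α N αᴺ≈1 q = trans (pow-pow α N q) (trans (pow-cong q αᴺ≈1) (pow-1# q))

  ≈ₚ-refl : ∀ {P} → P ≈ₚ P
  ≈ₚ-refl i = refl

  ≈ₚ-sym : ∀ {P Q} → P ≈ₚ Q → Q ≈ₚ P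
  ≈ₚ-sym P≈Q i = sym (P≈Q i)

  ≈ₚ-trans : ∀ {P Q S} → P ≈ₚ Q → Q ≈ₚ S → P ≈ₚ S
  ≈ₚ-trans P≈Q Q≈S i = trans (P≈Q i) (Q≈S i)

  eval-cong : ∀ P Q x → P ≈ₚ Q → eval P x ≈ eval Q x
  eval-cong []      []      x P≈Q = refl
  eval-cong []      (b ∷ Q) x P≈Q = sym (trans (+-cong (sym (P≈Q 0)) (trans (*-congˡ (sym (eval-cong [] Q x (P≈Q ∘ suc)))) (zeroʳ x))) (+-identityˡ _))
  eval-cong (a ∷ P) []      x P≈Q = trans (+-cong (P≈Q 0) (trans (*-congˡ (eval-cong P [] x (P≈Q ∘ suc))) (zeroʳ x))) (+-identityˡ _)
  eval-cong (a ∷ P) (b ∷ Q) x P≈Q = +-cong (P≈Q 0) (*-congˡ (eval-cong P Q x (P≈Q ∘ suc)))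

  eval-arg : ∀ P {x y} → x ≈ y → eval P x ≈ eval P y
  eval-arg []      x≈y = refl
  eval-arg (a ∷ P) x≈y = +-congˡ (*-cong x≈y (eval-arg P x≈y))

  coeff-⊕ : ∀ P Q i → coeff (P ⊕ Q) i ≈ coeff P i + coeff Q i
  coeff-⊕ []      Q       i       = sym (+-identityˡ _)
  coeff-⊕ (a ∷ P) []      i       = sym (+-identityʳ _)
  coeff-⊕ (a ∷ P) (b ∷ Q) zero    = refl
  coeff-⊕ (a ∷ P) (b ∷ Q) (suc i) = coeff-⊕ P Q i

  coeff-twistFrom : ∀ c acc P i → coeff (twistFrom c acc P) i ≈ acc * pow c i * coeff P i
  coeff-twistFrom c acc []      i       = sym (zeroʳ _)
  coeff-twistFrom c acc (a ∷ P) zero    = *-congʳ (sym (*-identityʳ _))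
  coeff-twistFrom c acc (a ∷ P) (suc i) = trans (coeff-twistFrom c (acc * c) P i) (*-congʳ (*-assoc _ _ _))

  coeff-beyond : ∀ P i → length P ≤ i → coeff P i ≡ 0#
  coeff-beyond []      i       _         = ≡.refl
  coeff-beyond (a ∷ P) (suc i) (s≤s len) = coeff-beyond P i len

  coeff-shift-+ : ∀ m Q i → coeff (replicate m 0# ++ Q) (m ℕ.+ i) ≡ coeff Q i
  coeff-shift-+ zero    Q i = ≡.refl
  coeff-shift-+ (suc m) Q i = coeff-shift-+ m Q i

  coeff-shift-< : ∀ m Q i → i < m → coeff (replicate m 0# ++ Q) i ≡ 0#
  coeff-shift-< (suc m) Q zero    _         = ≡.refl
  coeff-shift-< (suc m) Q (suc i) (s≤s i<m) = coeff-shift-< m Q i i<m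

  coeff-subPow-* : ∀ m G q → coeff (subPow (suc m) G) (q ℕ.* suc m) ≡ coeff G q
  coeff-subPow-* m []      q       = ≡.refl
  coeff-subPow-* m (a ∷ G) zero    = ≡.refl
  coeff-subPow-* m (a ∷ G) (suc q) = ≡.trans (coeff-shift-+ m (subPow (suc m) G) (q ℕ.* suc m)) (coeff-subPow-* m G q)

  coeff-subPow-∤ : ∀ m G i → ¬ (suc m ℕ.∣ i) → coeff (subPow (suc m) G) i ≡ 0#
  coeff-subPow-∤ m []      i       _   = ≡.refl
  coeff-subPow-∤ m (a ∷ G) zero    m∤i = ⊥-elim (m∤i (suc m ∣0))
  coeff-subPow-∤ m (a ∷ G) (suc i) m∤i with ℕ.<-cmp i m
  ... | tri< i<m _ _ = coeff-shift-< m _ i i<m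
  ... | tri≈ _ ≡.refl _ = ⊥-elim (m∤i ∣-refl)
  ... | tri> _ _ m<i with ℕ.m≤n⇒∃[o]m+o≡n (ℕ.<⇒≤ m<i)
  ...   | r , ≡.refl = ≡.trans (coeff-shift-+ m _ r) (coeff-subPow-∤ m G r (λ m∣r → m∤i (∣m∣n⇒∣m+n (∣-refl {suc m}) m∣r)))

module EvalHom {a la c ℓ} (A : CommutativeRing a la) (R : CommutativeRing c ℓ)
  (φ : CommutativeRing.Carrier A → CommutativeRing.Carrier R) where
  private
    module A = CommutativeRing A
    module PA = PolyOps A
  open CommutativeRing R
  open PolyOps R
  open RingLemmas R
  open IntCast R using (solve; _:=_; _:+_; _:*_; :-_)
  open import Algebra.Properties.Group +-group using (inverseˡ-unique; ε⁻¹≈ε)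
  open import Relation.Binary.Reasoning.Setoid setoid

  record IsRingHom : Set (a ⊔ la ⊔ ℓ) where
    field
      φ-cong : ∀ {x y} → x A.≈ y → φ x ≈ φ y
      φ-+    : ∀ x y → φ (x A.+ y) ≈ φ x + φ y
      φ-*    : ∀ x y → φ (x A.* y) ≈ φ x * φ y
      φ-0    : φ A.0# ≈ 0#
      φ-1    : φ A.1# ≈ 1#

  evalMap : PA.Poly → Carrier → Carrier
  evalMap P x = eval (map φ P) x

  module _ (hom : IsRingHom) where
    open IsRingHom hom

    φ-neg : ∀ x → φ (A.- x) ≈ - φ x
    φ-neg x = inverseˡ-unique _ _ (trans (sym (φ-+ (A.- x) x)) (trans (φ-cong (A.-‿inverseˡ x)) φ-0))

    φ-pow : ∀ x n → φ (PA.pow x n) ≈ pow (φ x) n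
    φ-pow x zero    = φ-1
    φ-pow x (suc n) = trans (φ-* x (PA.pow x n)) (*-congˡ (φ-pow x n))

    coeff-map : ∀ P i → coeff (map φ P) i ≈ φ (PA.coeff P i)
    coeff-map []      i       = sym φ-0
    coeff-map (b ∷ P) zero    = refl
    coeff-map (b ∷ P) (suc i) = coeff-map P i

    evalMap-cong : ∀ {P Q} x → P PA.≈ₚ Q → evalMap P x ≈ evalMap Q x
    evalMap-cong {P} {Q} x P≈Q = eval-cong (map φ P) (map φ Q) x
      (λ i → trans (coeff-map P i) (trans (φ-cong (P≈Q i)) (sym (coeff-map Q i))))

    evalMap-⊕ : ∀ P Q x → evalMap (P PA.⊕ Q) x ≈ evalMap P x + evalMap Q x
    evalMap-⊕ []      Q       x = sym (+-identityˡ _)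
    evalMap-⊕ (b ∷ P) []      x = sym (+-identityʳ _)
    evalMap-⊕ (b ∷ P) (d ∷ Q) x = begin
      φ (b A.+ d) + x * evalMap (P PA.⊕ Q) x        ≈⟨ +-cong (φ-+ b d) (*-congˡ (evalMap-⊕ P Q x)) ⟩
      (φ b + φ d) + x * (evalMap P x + evalMap Q x)
        ≈⟨ solve 5 (λ b d x u v → (b :+ d) :+ x :* (u :+ v) := (b :+ x :* u) :+ (d :+ x :* v)) refl (φ b) (φ d) x (evalMap P x) (evalMap Q x) ⟩
      (φ b + x * evalMap P x) + (φ d + x * evalMap Q x) ∎

    evalMap-scale : ∀ b P x → evalMap (PA.scale b P) x ≈ φ b * evalMap P x
    evalMap-scale b []      x = sym (zeroʳ _)
    evalMap-scale b (d ∷ P) x = begin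
      φ (b A.* d) + x * evalMap (PA.scale b P) x ≈⟨ +-cong (φ-* b d) (*-congˡ (evalMap-scale b P x)) ⟩
      φ b * φ d + x * (φ b * evalMap P x)        ≈⟨ solve 4 (λ b d x u → b :* d :+ x :* (b :* u) := b :* (d :+ x :* u)) refl (φ b) (φ d) x (evalMap P x) ⟩
      φ b * (φ d + x * evalMap P x)              ∎

    evalMap-neg : ∀ P x → evalMap (PA.neg P) x ≈ - evalMap P x
    evalMap-neg []      x = sym ε⁻¹≈ε
    evalMap-neg (d ∷ P) x = begin
      φ (A.- d) + x * evalMap (PA.neg P) x ≈⟨ +-cong (φ-neg d) (*-congˡ (evalMap-neg P x)) ⟩
      - φ d + x * (- evalMap P x)          ≈⟨ solve 3 (λ d x u → :- d :+ x :* (:- u) := :- (d :+ x :* u)) refl (φ d) x (evalMap P x) ⟩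
      - (φ d + x * evalMap P x)            ∎

    evalMap-⊗ : ∀ P Q x → evalMap (P PA.⊗ Q) x ≈ evalMap P x * evalMap Q x
    evalMap-⊗ []      Q x = sym (zeroˡ _)
    evalMap-⊗ (b ∷ P) Q x = begin
      evalMap (PA.scale b Q PA.⊕ (A.0# ∷ (P PA.⊗ Q))) x       ≈⟨ evalMap-⊕ (PA.scale b Q) (A.0# ∷ (P PA.⊗ Q)) x ⟩
      evalMap (PA.scale b Q) x + (φ A.0# + x * evalMap (P PA.⊗ Q) x)
        ≈⟨ +-cong (evalMap-scale b Q x) (trans (+-cong φ-0 (*-congˡ (evalMap-⊗ P Q x))) (+-identityˡ _)) ⟩
      φ b * evalMap Q x + x * (evalMap P x * evalMap Q x)     ≈⟨ solve 4 (λ b q x u → b :* q :+ x :* (u :* q) := (b :+ x :* u) :* q) refl (φ b) (evalMap Q x) x (evalMap P x) ⟩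
      (φ b + x * evalMap P x) * evalMap Q x                   ∎

    evalMap-const : ∀ b x → evalMap (PA.const b) x ≈ φ b
    evalMap-const b x = trans (+-congˡ (zeroʳ x)) (+-identityʳ _)

    evalMap-X : ∀ x → evalMap PA.X x ≈ x
    evalMap-X x = trans (+-cong φ-0 (*-congˡ (evalMap-const A.1# x))) (trans (+-identityˡ _) (trans (*-congˡ φ-1) (*-identityʳ x)))

    evalMap-powₚ : ∀ P n x → evalMap (PA.powₚ P n) x ≈ pow (evalMap P x) n
    evalMap-powₚ P zero    x = trans (evalMap-const A.1# x) φ-1
    evalMap-powₚ P (suc n) x = trans (evalMap-⊗ P (PA.powₚ P n) x) (*-congˡ (evalMap-powₚ P n x))

    evalMap-twistFrom : ∀ b acc P x → evalMap (PA.twistFrom b acc P) x ≈ φ acc * evalMap P (φ b * x)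
    evalMap-twistFrom b acc []      x = sym (zeroʳ _)
    evalMap-twistFrom b acc (d ∷ P) x = begin
      φ (acc A.* d) + x * evalMap (PA.twistFrom b (acc A.* b) P) x
        ≈⟨ +-cong (φ-* acc d) (*-congˡ (trans (evalMap-twistFrom b (acc A.* b) P x) (*-congʳ (φ-* acc b)))) ⟩
      φ acc * φ d + x * ((φ acc * φ b) * evalMap P (φ b * x))
        ≈⟨ solve 5 (λ a d x b u → a :* d :+ x :* ((a :* b) :* u) := a :* (d :+ (b :* x) :* u)) refl (φ acc) (φ d) x (φ b) (evalMap P (φ b * x)) ⟩
      φ acc * (φ d + (φ b * x) * evalMap P (φ b * x)) ∎

    evalMap-twist : ∀ b P x → evalMap (PA.twist b P) x ≈ evalMap P (φ b * x)
    evalMap-twist b P x = trans (evalMap-twistFrom b A.1# P x) (trans (*-congʳ φ-1) (*-identityˡ _))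

    evalMap-prodₚ : ∀ n f x → evalMap (PA.prodₚ n f) x ≈ ∏ n (λ j → evalMap (f j) x)
    evalMap-prodₚ zero    f x = trans (evalMap-const A.1# x) φ-1
    evalMap-prodₚ (suc n) f x = trans (evalMap-⊗ (f n) (PA.prodₚ n f) x) (*-congˡ (evalMap-prodₚ n f x))

    evalMap-shift : ∀ n Q x → evalMap (replicate n A.0# ++ Q) x ≈ pow x n * evalMap Q x
    evalMap-shift zero    Q x = sym (*-identityˡ _)
    evalMap-shift (suc n) Q x = begin
      φ A.0# + x * evalMap (replicate n A.0# ++ Q) x ≈⟨ trans (+-cong φ-0 (*-congˡ (evalMap-shift n Q x))) (+-identityˡ _) ⟩
      x * (pow x n * evalMap Q x)                    ≈⟨ *-assoc _ _ _ ⟨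
      x * pow x n * evalMap Q x                      ∎

    evalMap-subPow : ∀ n P x → evalMap (PA.subPow (suc n) P) x ≈ evalMap P (pow x (suc n))
    evalMap-subPow n []      x = refl
    evalMap-subPow n (d ∷ P) x = +-congˡ (begin
      x * evalMap (replicate n A.0# ++ PA.subPow (suc n) P) x ≈⟨ *-congˡ (evalMap-shift n _ x) ⟩
      x * (pow x n * evalMap (PA.subPow (suc n) P) x)         ≈⟨ *-assoc _ _ _ ⟨
      pow x (suc n) * evalMap (PA.subPow (suc n) P) x         ≈⟨ *-congˡ (evalMap-subPow n P x) ⟩
      pow x (suc n) * evalMap P (pow x (suc n))               ∎)

module Eval {c ℓ} (R : CommutativeRing c ℓ) where
  open CommutativeRing R
  open PolyOps R
  open RingLemmas R using (∏; ∏-cong; pow-cong)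
  open EvalHom R R id

  idHom : IsRingHom
  idHom = record { φ-cong = id ; φ-+ = λ _ _ → refl ; φ-* = λ _ _ → refl ; φ-0 = refl ; φ-1 = refl }

  private
    unmap : ∀ P x → eval P x ≈ evalMap P x
    unmap P x = reflexive (≡.cong (λ Q → eval Q x) (≡.sym (List.map-id P)))

  eval-⊕ : ∀ P Q x → eval (P ⊕ Q) x ≈ eval P x + eval Q x
  eval-⊕ P Q x = trans (unmap (P ⊕ Q) x) (trans (evalMap-⊕ idHom P Q x) (+-cong (sym (unmap P x)) (sym (unmap Q x))))

  eval-⊗ : ∀ P Q x → eval (P ⊗ Q) x ≈ eval P x * eval Q x
  eval-⊗ P Q x = trans (unmap (P ⊗ Q) x) (trans (evalMap-⊗ idHom P Q x) (*-cong (sym (unmap P x)) (sym (unmap Q x))))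

  eval-neg : ∀ P x → eval (neg P) x ≈ - eval P x
  eval-neg P x = trans (unmap (neg P) x) (trans (evalMap-neg idHom P x) (-‿cong (sym (unmap P x))))

  eval-const : ∀ a x → eval (const a) x ≈ a
  eval-const a x = trans (unmap (const a) x) (evalMap-const idHom a x)

  eval-X : ∀ x → eval X x ≈ x
  eval-X x = trans (unmap X x) (evalMap-X idHom x)

  eval-powₚ : ∀ P n x → eval (powₚ P n) x ≈ pow (eval P x) n
  eval-powₚ P n x = trans (unmap (powₚ P n) x) (trans (evalMap-powₚ idHom P n x) (pow-cong n (sym (unmap P x))))

  eval-twist : ∀ b P x → eval (twist b P) x ≈ eval P (b * x)
  eval-twist b P x = trans (unmap (twist b P) x) (trans (evalMap-twist idHom b P x) (sym (unmap P (b * x))))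

  eval-prodₚ : ∀ n f x → eval (prodₚ n f) x ≈ ∏ n (λ j → eval (f j) x)
  eval-prodₚ n f x = trans (unmap (prodₚ n f) x) (trans (evalMap-prodₚ idHom n f x) (∏-cong n (λ j → sym (unmap (f j) x))))

  eval-shift : ∀ n Q x → eval (replicate n 0# ++ Q) x ≈ pow x n * eval Q x
  eval-shift n Q x = trans (unmap (replicate n 0# ++ Q) x) (trans (evalMap-shift idHom n Q x) (*-congˡ (sym (unmap Q x))))

-- Integral domains of characteristic zero

module Char0Domain {c ℓ} (R : CommutativeRing c ℓ) (D : Cast.IsChar0Domain R) where
  open CommutativeRing R
  open PolyOps R
  open Cast R
  open Cast.IsChar0Domain D
  open IntCast R
  open RingLemmas R
  open Eval R
  open import Algebra.Properties.Group +-group using (x∙y⁻¹≈ε⇒x≈y; ε⁻¹≈ε)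
  open import Relation.Binary.Reasoning.Setoid setoid

  *≈0⇒≈0 : ∀ {a b} → a * b ≈ 0# → ¬ (a ≈ 0#) → b ≈ 0#
  *≈0⇒≈0 {a} {b} ab≈0 a≉0 with noZeroDivs a b ab≈0
  ... | inj₁ a≈0 = ⊥-elim (a≉0 a≈0)
  ... | inj₂ b≈0 = b≈0

  1#≉0# : ¬ (1# ≈ 0#)
  1#≉0# 1≈0 with char0 (+ 1) (trans ι-1 1≈0)
  ... | ()

  natCast-suc≉0# : ∀ n → ¬ (natCast (suc n) ≈ 0#)
  natCast-suc≉0# n n+1≈0 with char0 (+ suc n) n+1≈0
  ... | ()

  ι-injective : ∀ {a b} → ι a ≈ ι b → a ≡ b
  ι-injective {a} {b} ιa≈ιb = ℤ.i-j≡0⇒i≡j a b (char0 _ (begin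
    ι (a ℤ.- b)       ≈⟨ ι-+ a (ℤ.- b) ⟩
    ι a + ι (ℤ.- b)   ≈⟨ +-cong ιa≈ιb (ι-neg b) ⟩
    ι b - ι b         ≈⟨ -‿inverseʳ _ ⟩
    0#                ∎))

  natCast-injective : ∀ {m n} → natCast m ≈ natCast n → m ≡ n
  natCast-injective eq = ℤ.+-injective (ι-injective eq)

  Distinct : List Carrier → Set _
  Distinct = AllPairs (λ x y → ¬ (x ≈ y))

  Roots : Poly → List Carrier → Set _
  Roots P = All (λ r → eval P r ≈ 0#)

  divLinear : Carrier → Poly → Poly
  divLinear r []           = []
  divLinear r (a ∷ [])     = []
  divLinear r (a ∷ b ∷ P)  = eval (b ∷ P) r ∷ divLinear r (b ∷ P)

  length-divLinear : ∀ r P n → length P ≤ suc n → length (divLinear r P) ≤ n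
  length-divLinear r []          n       _         = z≤n
  length-divLinear r (a ∷ [])    n       _         = z≤n
  length-divLinear r (a ∷ b ∷ P) (suc n) (s≤s len) = s≤s (length-divLinear r (b ∷ P) n len)

  eval-divLinear : ∀ r P y → eval P y ≈ eval P r + (y - r) * eval (divLinear r P) y
  eval-divLinear r []          y = sym (trans (+-identityˡ _) (zeroʳ _))
  eval-divLinear r (a ∷ [])    y = solve 3 (λ a y r → a :+ y :* con (+ 0) := (a :+ r :* con (+ 0)) :+ (y :- r) :* con (+ 0)) refl a y r
  eval-divLinear r (a ∷ b ∷ P) y = begin
    a + y * eval (b ∷ P) y                                                      ≈⟨ +-congˡ (*-congˡ (eval-divLinear r (b ∷ P) y)) ⟩
    a + y * (eval (b ∷ P) r + (y - r) * eval (divLinear r (b ∷ P)) y)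
      ≈⟨ solve 5 (λ a y r e q → a :+ y :* (e :+ (y :- r) :* q) := (a :+ r :* e) :+ (y :- r) :* (e :+ y :* q)) refl a y r (eval (b ∷ P) r) (eval (divLinear r (b ∷ P)) y) ⟩
    (a + r * eval (b ∷ P) r) + (y - r) * (eval (b ∷ P) r + y * eval (divLinear r (b ∷ P)) y) ∎

  coeff-divLinear-0 : ∀ r P → coeff P 0 ≈ eval P r - r * coeff (divLinear r P) 0
  coeff-divLinear-0 r []          = solve 1 (λ r → con (+ 0) := con (+ 0) :- r :* con (+ 0)) refl r
  coeff-divLinear-0 r (a ∷ [])    = solve 2 (λ a r → a := (a :+ r :* con (+ 0)) :- r :* con (+ 0)) refl a r
  coeff-divLinear-0 r (a ∷ b ∷ P) = solve 3 (λ a r e → a := (a :+ r :* e) :- r :* e) refl a r (eval (b ∷ P) r)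

  coeff-divLinear-suc : ∀ r P k → coeff P (suc k) ≈ coeff (divLinear r P) k - r * coeff (divLinear r P) (suc k)
  coeff-divLinear-suc r []          k       = solve 1 (λ r → con (+ 0) := con (+ 0) :- r :* con (+ 0)) refl r
  coeff-divLinear-suc r (a ∷ [])    k       = solve 1 (λ r → con (+ 0) := con (+ 0) :- r :* con (+ 0)) refl r
  coeff-divLinear-suc r (a ∷ b ∷ P) zero    = coeff-divLinear-0 r (b ∷ P)
  coeff-divLinear-suc r (a ∷ b ∷ P) (suc k) = coeff-divLinear-suc r (b ∷ P) k

  roots-divLinear : ∀ r rs P → All (λ s → ¬ (r ≈ s)) rs → eval P r ≈ 0# → Roots P rs → Roots (divLinear r P) rs
  roots-divLinear r []       P _           _      _            = []
  roots-divLinear r (s ∷ rs) P (r≉s ∷ r≉rs) Pr≈0 (Ps≈0 ∷ Prs≈0) =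
    *≈0⇒≈0 [s-r]Q[s]≈0 (λ s-r≈0 → r≉s (sym (x∙y⁻¹≈ε⇒x≈y s r s-r≈0))) ∷ roots-divLinear r rs P r≉rs Pr≈0 Prs≈0
    where
    [s-r]Q[s]≈0 : (s - r) * eval (divLinear r P) s ≈ 0#
    [s-r]Q[s]≈0 = begin
      (s - r) * eval (divLinear r P) s          ≈⟨ +-identityˡ _ ⟨
      0# + (s - r) * eval (divLinear r P) s     ≈⟨ +-congʳ Pr≈0 ⟨
      eval P r + (s - r) * eval (divLinear r P) s ≈⟨ eval-divLinear r P s ⟨
      eval P s                                  ≈⟨ Ps≈0 ⟩
      0#                                        ∎

  private
    a-r*0≈a : ∀ a r {z} → z ≈ 0# → a - r * z ≈ a
    a-r*0≈a a r z≈0 = trans (+-congˡ (-‿cong (trans (*-congˡ z≈0) (zeroʳ r)))) (trans (+-congˡ ε⁻¹≈ε) (+-identityʳ a))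

  roots⇒coeff≈0 : ∀ rs P → length P ≤ length rs → Distinct rs → Roots P rs → ∀ i → coeff P i ≈ 0#
  roots⇒coeff≈0 []       []  _   _               _              i = refl
  roots⇒coeff≈0 (r ∷ rs) P   len (r≉rs ∷ distinct) (Pr≈0 ∷ Prs≈0) = coeff≈0
    where
    Q≈0 : ∀ i → coeff (divLinear r P) i ≈ 0#
    Q≈0 = roots⇒coeff≈0 rs (divLinear r P) (length-divLinear r P (length rs) len) distinct (roots-divLinear r rs P r≉rs Pr≈0 Prs≈0)
    coeff≈0 : ∀ i → coeff P i ≈ 0#
    coeff≈0 zero    = trans (coeff-divLinear-0 r P) (trans (a-r*0≈a _ r (Q≈0 0)) Pr≈0)
    coeff≈0 (suc k) = trans (coeff-divLinear-suc r P k) (trans (a-r*0≈a _ r (Q≈0 (suc k))) (Q≈0 k))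

  roots⇒factor : ∀ rs P → length P ≤ suc (length rs) → Distinct rs → Roots P rs →
                 ∀ y → eval P y ≈ coeff P (length rs) * foldr (λ r t → (y - r) * t) 1# rs
  roots⇒factor []       []              _         _ _ y = sym (zeroˡ _)
  roots⇒factor []       (a ∷ [])        _         _ _ y = trans (+-congˡ (zeroʳ y)) (trans (+-identityʳ a) (sym (*-identityʳ a)))
  roots⇒factor []       (a ∷ b ∷ P)     (s≤s ())  _ _ y
  roots⇒factor (r ∷ rs) P len (r≉rs ∷ distinct) (Pr≈0 ∷ Prs≈0) y = begin
    eval P y                                          ≈⟨ eval-divLinear r P y ⟩
    eval P r + (y - r) * eval Q y                     ≈⟨ trans (+-cong Pr≈0 (*-congˡ IH)) (+-identityˡ _) ⟩
    (y - r) * (coeff Q n * Π rs)                      ≈⟨ solve 3 (λ a b c → a :* (b :* c) := b :* (a :* c)) refl (y - r) (coeff Q n) _ ⟩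
    coeff Q n * ((y - r) * Π rs)                      ≈⟨ *-congʳ leading ⟨
    coeff P (suc n) * ((y - r) * Π rs)                ∎
    where
    n : ℕ
    n = length rs
    Q : Poly
    Q = divLinear r P
    Π : List Carrier → Carrier
    Π = foldr (λ r t → (y - r) * t) 1#
    lenQ : length Q ≤ suc n
    lenQ = length-divLinear r P (suc n) len
    IH : eval Q y ≈ coeff Q n * Π rs
    IH = roots⇒factor rs Q lenQ distinct (roots-divLinear r rs P r≉rs Pr≈0 Prs≈0) y
    leading : coeff P (suc n) ≈ coeff Q n
    leading = trans (coeff-divLinear-suc r P n) (a-r*0≈a _ r (reflexive (coeff-beyond Q (suc n) lenQ)))

  private
    naturals : ℕ → List Carrier
    naturals zero    = []
    naturals (suc n) = natCast n ∷ naturals n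

    length-naturals : ∀ n → length (naturals n) ≡ n
    length-naturals zero    = ≡.refl
    length-naturals (suc n) = ≡.cong suc (length-naturals n)

    All-naturals : ∀ n (P : Carrier → Set ℓ) → (∀ m → m < n → P (natCast m)) → All P (naturals n)
    All-naturals zero    P h = []
    All-naturals (suc n) P h = h n ℕ.≤-refl ∷ All-naturals n P (λ m m<n → h m (ℕ.m<n⇒m<1+n m<n))

    distinct-naturals : ∀ n → Distinct (naturals n)
    distinct-naturals zero    = []
    distinct-naturals (suc n) =
      All-naturals n _ (λ m m<n n≈m → ℕ.<-irrefl (≡.sym (natCast-injective n≈m)) m<n) ∷ distinct-naturals n

  eval≈⇒≈ₚ : ∀ P Q → (∀ x → eval P x ≈ eval Q x) → P ≈ₚ Q
  eval≈⇒≈ₚ P Q P≈Q i = x∙y⁻¹≈ε⇒x≈y _ _ (begin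
      coeff P i - coeff Q i                       ≈⟨ +-congˡ (coeff-neg Q i) ⟨
      coeff P i + coeff (neg Q) i                 ≈⟨ coeff-⊕ P (neg Q) i ⟨
      coeff (P ⊕ neg Q) i                         ≈⟨ roots⇒coeff≈0 (naturals L) (P ⊕ neg Q) len (distinct-naturals L) roots i ⟩
      0#                                          ∎)
    where
    L : ℕ
    L = length (P ⊕ neg Q)
    len : L ≤ length (naturals L)
    len = ℕ.≤-reflexive (≡.sym (length-naturals L))
    coeff-neg : ∀ Q i → coeff (neg Q) i ≈ - coeff Q i
    coeff-neg []      i       = sym ε⁻¹≈ε
    coeff-neg (b ∷ Q) zero    = refl
    coeff-neg (b ∷ Q) (suc i) = coeff-neg Q i
    roots : Roots (P ⊕ neg Q) (naturals L)
    roots = All-naturals L _ (λ m _ → trans (eval-⊕ P (neg Q) _) (trans (+-cong (P≈Q _) (eval-neg Q _)) (-‿inverseʳ _)))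

  primitive-pow : ∀ a b ζ → IsPrimitiveRoot (a ℕ.* b) ζ → 0 < a → IsPrimitiveRoot b (pow ζ a)
  primitive-pow a b ζ (ζᵃᵇ≈1 , minimal) 0<a = ζᵃ^b≈1 , ζᵃ-minimal
    where
    ζᵃ^b≈1 : pow (pow ζ a) b ≈ 1#
    ζᵃ^b≈1 = trans (sym (pow-pow ζ a b)) (trans (reflexive (≡.cong (pow ζ) (ℕ.*-comm b a))) ζᵃᵇ≈1)
    ζᵃ-minimal : ∀ k → 0 < k → k < b → ¬ (pow (pow ζ a) k ≈ 1#)
    ζᵃ-minimal k 0<k k<b ζᵃᵏ≈1 = minimal (a ℕ.* k) (ℕ.*-mono-< 0<a 0<k) (ℕ.*-monoʳ-< a {{ℕ.>-nonZero 0<a}} k<b)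
      (trans (reflexive (≡.cong (pow ζ) (ℕ.*-comm a k))) (trans (pow-pow ζ a k) ζᵃᵏ≈1))

  private
    powers : Carrier → ℕ → List Carrier
    powers α zero    = []
    powers α (suc k) = pow α k ∷ powers α k

    length-powers : ∀ α k → length (powers α k) ≡ k
    length-powers α zero    = ≡.refl
    length-powers α (suc k) = ≡.cong suc (length-powers α k)

    All-powers : ∀ α k (P : Carrier → Set ℓ) → (∀ m → m < k → P (pow α m)) → All P (powers α k)
    All-powers α zero    P h = []
    All-powers α (suc k) P h = h k ℕ.≤-refl ∷ All-powers α k P (λ m m<k → h m (ℕ.m<n⇒m<1+n m<k))

    Any-powers : ∀ α k (P : Carrier → Set ℓ) → Any P (powers α k) → Σ ℕ (λ m → m < k × P (pow α m))
    Any-powers α (suc k) P (here p)  = k , ℕ.≤-refl , p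
    Any-powers α (suc k) P (there a) with Any-powers α k P a
    ... | m , m<k , p = m , ℕ.m<n⇒m<1+n m<k , p

    Any-factor≈0 : ∀ y rs → foldr (λ r t → (y - r) * t) 1# rs ≈ 0# → Any (λ r → y - r ≈ 0#) rs
    Any-factor≈0 y []       1≈0 = ⊥-elim (1#≉0# 1≈0)
    Any-factor≈0 y (r ∷ rs) prod≈0 with noZeroDivs (y - r) _ prod≈0
    ... | inj₁ y-r≈0 = here y-r≈0
    ... | inj₂ rest≈0 = there (Any-factor≈0 y rs rest≈0)

    unityPoly : ℕ → Poly
    unityPoly n = - 1# ∷ (replicate n 0# ++ 1# ∷ [])

    eval-unityPoly : ∀ n y → eval (unityPoly n) y ≈ pow y (suc n) - 1#
    eval-unityPoly n y = begin
      - 1# + y * eval (replicate n 0# ++ 1# ∷ []) y   ≈⟨ +-congˡ (*-congˡ (trans (eval-shift n (1# ∷ []) y) (*-congˡ (eval-const 1# y)))) ⟩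
      - 1# + y * (pow y n * 1#)                       ≈⟨ +-congˡ (*-congˡ (*-identityʳ _)) ⟩
      - 1# + pow y (suc n)                            ≈⟨ +-comm _ _ ⟩
      pow y (suc n) - 1#                              ∎

    length-unityPoly : ∀ n → length (unityPoly n) ≡ suc (suc n)
    length-unityPoly n = ≡.cong suc (≡.trans (List.length-++ (replicate n 0#))
      (≡.trans (≡.cong (ℕ._+ 1) (List.length-replicate n)) (ℕ.+-comm n 1)))

    leading-unityPoly : ∀ n → coeff (unityPoly n) (suc n) ≡ 1#
    leading-unityPoly zero    = ≡.refl
    leading-unityPoly (suc n) = leading-unityPoly n

  module _ {n α} (prim : IsPrimitiveRoot (suc n) α) where
    private
      αⁿ⁺¹≈1 : pow α (suc n) ≈ 1#
      αⁿ⁺¹≈1 = proj₁ prim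

      α≉0 : ¬ (α ≈ 0#)
      α≉0 α≈0 = 1#≉0# (trans (sym αⁿ⁺¹≈1) (trans (*-congʳ α≈0) (zeroˡ _)))

      pow≉0 : ∀ j → ¬ (pow α j ≈ 0#)
      pow≉0 zero    = 1#≉0#
      pow≉0 (suc j) αʲ⁺¹≈0 with noZeroDivs α (pow α j) αʲ⁺¹≈0
      ... | inj₁ α≈0  = α≉0 α≈0
      ... | inj₂ αʲ≈0 = pow≉0 j αʲ≈0

      pow-injective : ∀ m d → suc d < suc n → ¬ (pow α (m ℕ.+ suc d) ≈ pow α m)
      pow-injective m d d<n eq = proj₂ prim (suc d) (s≤s z≤n) d<n (x∙y⁻¹≈ε⇒x≈y _ _ (*≈0⇒≈0 αᵐ[αᵈ⁺¹-1]≈0 (pow≉0 m)))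
        where
        αᵐ[αᵈ⁺¹-1]≈0 : pow α m * (pow α (suc d) - 1#) ≈ 0#
        αᵐ[αᵈ⁺¹-1]≈0 = begin
          pow α m * (pow α (suc d) - 1#)          ≈⟨ solve 3 (λ a b o → a :* (b :- o) := a :* b :- a :* o) refl (pow α m) (pow α (suc d)) 1# ⟩
          pow α m * pow α (suc d) - pow α m * 1#  ≈⟨ +-cong (sym (pow-+ α m (suc d))) (-‿cong (*-identityʳ _)) ⟩
          pow α (m ℕ.+ suc d) - pow α m           ≈⟨ trans (+-congʳ eq) (-‿inverseʳ _) ⟩
          0#                                      ∎

      distinct-powers : ∀ k → k ≤ suc n → Distinct (powers α k)
      distinct-powers zero    _   = []
      distinct-powers (suc k) k<n = All-powers α k _ differ ∷ distinct-powers k (ℕ.≤-trans (ℕ.n≤1+n k) k<n)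
        where
        differ : ∀ m → m < k → ¬ (pow α k ≈ pow α m)
        differ m m<k eq with ℕ.m≤n⇒∃[o]m+o≡n m<k
        ... | d , m+1+d≡k = pow-injective m d d<n (trans (reflexive (≡.cong (pow α) (≡.trans (ℕ.+-suc m d) m+1+d≡k))) eq)
          where
          d<n : suc d < suc n
          d<n = ℕ.≤-trans (s≤s (ℕ.≤-trans (s≤s (ℕ.m≤n+m d m)) (ℕ.≤-reflexive m+1+d≡k))) k<n

      powers-roots : Roots (unityPoly n) (powers α (suc n))
      powers-roots = All-powers α (suc n) _ (λ m _ → trans (eval-unityPoly n (pow α m))
        (trans (+-congʳ (trans (pow-comm α m (suc n)) (trans (pow-cong m αⁿ⁺¹≈1) (pow-1# m)))) (-‿inverseʳ _)))

    generates : ∀ β → pow β (suc n) ≈ 1# → Σ ℕ (λ m → m < suc n × β ≈ pow α m)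
    generates β βⁿ⁺¹≈1 =
      let m , m<n , β-αᵐ≈0 = Any-powers α (suc n) _ (Any-factor≈0 β rs factors≈0) in m , m<n , x∙y⁻¹≈ε⇒x≈y _ _ β-αᵐ≈0
      where
      rs : List Carrier
      rs = powers α (suc n)
      Π : Carrier
      Π = foldr (λ r t → (β - r) * t) 1# rs
      factors≈0 : Π ≈ 0#
      factors≈0 = begin
        Π                                        ≈⟨ *-identityˡ _ ⟨
        1# * Π                                   ≡⟨ ≡.cong (_* Π) (≡.sym (leading-unityPoly n)) ⟩
        coeff (unityPoly n) (suc n) * Π          ≡⟨ ≡.cong (λ k → coeff (unityPoly n) k * Π) (≡.sym (length-powers α (suc n))) ⟩
        coeff (unityPoly n) (length rs) * Π
          ≈⟨ roots⇒factor rs (unityPoly n) (ℕ.≤-reflexive (≡.trans (length-unityPoly n) (≡.cong suc (≡.sym (length-powers α (suc n))))))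
               (distinct-powers (suc n) ℕ.≤-refl) powers-roots β ⟨
        eval (unityPoly n) β                     ≈⟨ eval-unityPoly n β ⟩
        pow β (suc n) - 1#                       ≈⟨ trans (+-congʳ βⁿ⁺¹≈1) (-‿inverseʳ _) ⟩
        0#                                       ∎

  primitive-root-generates : ∀ {N α} → IsPrimitiveRoot N α → 0 < N → ∀ β → pow β N ≈ 1# → Σ ℕ (λ m → m < N × β ≈ pow α m)
  primitive-root-generates {suc n} prim _ = generates prim

  primitive⇒pow-coprime : ∀ {p K β γ} → Prime p → 0 < K → IsPrimitiveRoot (p ℕ.* K) β → IsPrimitiveRoot (p ℕ.* K) γ →
                          Σ ℕ (λ m → ¬ (p ℕ.∣ m) × β ≈ pow γ m)
  primitive⇒pow-coprime {p} {K} {β} {γ} pr 0<K (βᵖᴷ≈1 , β-minimal) primγ =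
    m , p∤m , β≈γᵐ
    where
    0<pK : 0 < p ℕ.* K
    0<pK = ℕ.*-mono-< (ℕ.<-trans (s≤s z≤n) (prime⇒1<p pr)) 0<K
    root : Σ ℕ (λ m → m < p ℕ.* K × β ≈ pow γ m)
    root = primitive-root-generates primγ 0<pK β βᵖᴷ≈1
    m : ℕ
    m = proj₁ root
    β≈γᵐ : β ≈ pow γ m
    β≈γᵐ = proj₂ (proj₂ root)
    p∤m : ¬ (p ℕ.∣ m)
    p∤m (divides q m≡qp) = β-minimal K 0<K K<pK (begin
      pow β K                   ≈⟨ pow-cong K β≈γᵐ ⟩
      pow (pow γ m) K           ≈⟨ pow-pow γ m K ⟨
      pow γ (K ℕ.* m)           ≡⟨ ≡.cong (pow γ) (≡.trans (≡.cong (K ℕ.*_) m≡qp) (≡.trans (ℕ.*-comm K (q ℕ.* p)) (ℕ.*-assoc q p K))) ⟩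
      pow γ (q ℕ.* (p ℕ.* K))   ≈⟨ pow-multiple γ (p ℕ.* K) (proj₁ primγ) q ⟩
      1#                        ∎)
      where
      K<pK : K < p ℕ.* K
      K<pK = ≡.subst (K <_) (ℕ.*-comm K p) (ℕ.m<m*n K p {{ℕ.>-nonZero 0<K}} (prime⇒1<p pr))

-- Products over lists of indices

private
  remove : ℕ → List ℕ → List ℕ
  remove x []       = []
  remove x (y ∷ ys) with x ℕ.≟ y
  ... | yes _ = ys
  ... | no _  = y ∷ remove x ys

  length-remove : ∀ {x} ys → x ∈ ys → suc (length (remove x ys)) ≡ length ys
  length-remove {x} (y ∷ ys) x∈ with x ℕ.≟ y
  ... | yes _ = ≡.refl
  length-remove {x} (y ∷ ys) (here x≡y)  | no x≢y = ⊥-elim (x≢y x≡y)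
  length-remove {x} (y ∷ ys) (there x∈) | no _   = ≡.cong suc (length-remove ys x∈)

  ∈-remove : ∀ {x z} ys → z ∈ ys → z ≢ x → z ∈ remove x ys
  ∈-remove {x} (y ∷ ys) z∈ z≢x with x ℕ.≟ y
  ∈-remove {x} (y ∷ ys) (here z≡y)  z≢x | yes x≡y = ⊥-elim (z≢x (≡.trans z≡y (≡.sym x≡y)))
  ∈-remove {x} (y ∷ ys) (there z∈)  z≢x | yes _   = z∈
  ∈-remove {x} (y ∷ ys) (here z≡y)  z≢x | no _    = here z≡y
  ∈-remove {x} (y ∷ ys) (there z∈)  z≢x | no _    = there (∈-remove ys z∈ z≢x)

  All-remove : ∀ {P : ℕ → Set} x ys → All P ys → All P (remove x ys)
  All-remove x []       []          = []
  All-remove x (y ∷ ys) (py ∷ pys) with x ℕ.≟ y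
  ... | yes _ = pys
  ... | no _  = py ∷ All-remove x ys pys

  unique-remove : ∀ x ys → Unique ys → Unique (remove x ys)
  unique-remove x []       []         = []
  unique-remove x (y ∷ ys) (y∉ ∷ uys) with x ℕ.≟ y
  ... | yes _ = uys
  ... | no _  = All-remove x ys y∉ ∷ unique-remove x ys uys

  All⇒∈ : ∀ {P : ℕ → Set} xs → All P xs → ∀ {x} → x ∈ xs → P x
  All⇒∈ (y ∷ xs) (py ∷ pxs) (here ≡.refl) = py
  All⇒∈ (y ∷ xs) (py ∷ pxs) (there x∈)    = All⇒∈ xs pxs x∈

  ∈⇒All : ∀ {P : ℕ → Set} xs → (∀ {x} → x ∈ xs → P x) → All P xs
  ∈⇒All []       h = []
  ∈⇒All (y ∷ xs) h = h (here ≡.refl) ∷ ∈⇒All xs (h ∘ there)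

  ∈-map⁻ : ∀ (f : ℕ → ℕ) xs {z} → z ∈ map f xs → Σ ℕ (λ y → y ∈ xs × z ≡ f y)
  ∈-map⁻ f (y ∷ xs) (here z≡fy) = y , here ≡.refl , z≡fy
  ∈-map⁻ f (y ∷ xs) (there z∈)  with ∈-map⁻ f xs z∈
  ... | w , w∈ , z≡fw = w , there w∈ , z≡fw

  unique-map : ∀ (f : ℕ → ℕ) xs → Unique xs → (∀ {x y} → x ∈ xs → y ∈ xs → f x ≡ f y → x ≡ y) → Unique (map f xs)
  unique-map f []       []         inj = []
  unique-map f (x ∷ xs) (x∉ ∷ uxs) inj =
    ∈⇒All (map f xs) (λ z∈ fx≡z → let w , w∈ , z≡fw = ∈-map⁻ f xs z∈ in
      All⇒∈ xs x∉ w∈ (inj (here ≡.refl) (there w∈) (≡.trans fx≡z z≡fw)))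
    ∷ unique-map f xs uxs (λ x∈ y∈ → inj (there x∈) (there y∈))

range : ℕ → List ℕ
range zero    = []
range (suc n) = n ∷ range n

∈-range : ∀ {n x} → x < n → x ∈ range n
∈-range {suc n} {x} x<n with x ℕ.≟ n
... | yes x≡n = here x≡n
... | no x≢n  = there (∈-range (ℕ.≤∧≢⇒< (ℕ.≤-pred x<n) x≢n))

∈-range⁻ : ∀ {n x} → x ∈ range n → x < n
∈-range⁻ {suc n} (here ≡.refl) = ℕ.≤-refl
∈-range⁻ {suc n} (there x∈)    = ℕ.m<n⇒m<1+n (∈-range⁻ x∈)

unique-range : ∀ n → Unique (range n)
unique-range zero    = []
unique-range (suc n) = ∈⇒All (range n) (λ x∈ n≡x → ℕ.<-irrefl (≡.sym n≡x) (∈-range⁻ x∈)) ∷ unique-range n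

coprimesTo : ℕ → ℕ → List ℕ
coprimesTo p zero    = []
coprimesTo p (suc n) = if does (p ∣? suc n) then coprimesTo p n else suc n ∷ coprimesTo p n

∈-coprimesTo⁻ : ∀ {p n x} → x ∈ coprimesTo p n → 0 < x × x ≤ n × ¬ (p ℕ.∣ x)
∈-coprimesTo⁻ {p} {suc n} x∈ with p ∣? suc n
∈-coprimesTo⁻ {p} {suc n} x∈            | yes _   = let 0<x , x≤n , p∤x = ∈-coprimesTo⁻ {p} {n} x∈ in 0<x , ℕ.m≤n⇒m≤1+n x≤n , p∤x
∈-coprimesTo⁻ {p} {suc n} (here ≡.refl) | no p∤n = s≤s z≤n , ℕ.≤-refl , p∤n
∈-coprimesTo⁻ {p} {suc n} (there x∈)    | no _   = let 0<x , x≤n , p∤x = ∈-coprimesTo⁻ {p} {n} x∈ in 0<x , ℕ.m≤n⇒m≤1+n x≤n , p∤x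

∈-coprimesTo : ∀ {p n x} → 0 < x → x ≤ n → ¬ (p ℕ.∣ x) → x ∈ coprimesTo p n
∈-coprimesTo {p} {zero}  0<x z≤n _ = ⊥-elim (ℕ.<-irrefl ≡.refl 0<x)
∈-coprimesTo {p} {suc n} {x} 0<x x≤n p∤x with p ∣? suc n | x ℕ.≟ suc n
... | yes p∣n | yes ≡.refl = ⊥-elim (p∤x p∣n)
... | yes _   | no x≢n     = ∈-coprimesTo 0<x (ℕ.≤-pred (ℕ.≤∧≢⇒< x≤n x≢n)) p∤x
... | no _    | yes x≡n    = here x≡n
... | no _    | no x≢n     = there (∈-coprimesTo 0<x (ℕ.≤-pred (ℕ.≤∧≢⇒< x≤n x≢n)) p∤x)

unique-coprimesTo : ∀ p n → Unique (coprimesTo p n)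
unique-coprimesTo p zero    = []
unique-coprimesTo p (suc n) with p ∣? suc n
... | yes _ = unique-coprimesTo p n
... | no _  = ∈⇒All (coprimesTo p n) (λ x∈ n≡x → ℕ.<-irrefl (≡.sym n≡x) (s≤s (proj₁ (proj₂ (∈-coprimesTo⁻ {p} {n} x∈))))) ∷ unique-coprimesTo p n

module IndexedProducts {c ℓ} (R : CommutativeRing c ℓ) where
  open CommutativeRing R
  open PolyOps R
  open IntCast R
  open RingLemmas R
  open import Relation.Binary.Reasoning.Setoid setoid

  ∏[_] : (ℕ → Carrier) → List ℕ → Carrier
  ∏[ h ] []       = 1#
  ∏[ h ] (x ∷ xs) = h x * ∏[ h ] xs

  ∏≡∏[range] : ∀ n h → ∏ n h ≡ ∏[ h ] (range n)
  ∏≡∏[range] zero    h = ≡.refl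
  ∏≡∏[range] (suc n) h = ≡.cong (h n *_) (∏≡∏[range] n h)

  ∏[]-cong : ∀ {h k} xs → (∀ {x} → x ∈ xs → h x ≈ k x) → ∏[ h ] xs ≈ ∏[ k ] xs
  ∏[]-cong []       h≈k = refl
  ∏[]-cong (x ∷ xs) h≈k = *-cong (h≈k (here ≡.refl)) (∏[]-cong xs (h≈k ∘ there))

  private
    ∏[]-map : ∀ h (f : ℕ → ℕ) xs → ∏[ h ] (map f xs) ≡ ∏[ h ∘ f ] xs
    ∏[]-map h f []       = ≡.refl
    ∏[]-map h f (x ∷ xs) = ≡.cong (h (f x) *_) (∏[]-map h f xs)

    ∏[]-remove : ∀ h {x} ys → x ∈ ys → ∏[ h ] ys ≈ h x * ∏[ h ] (remove x ys)
    ∏[]-remove h {x} (y ∷ ys) x∈ with x ℕ.≟ y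
    ... | yes ≡.refl = refl
    ∏[]-remove h {x} (y ∷ ys) (here x≡y) | no x≢y = ⊥-elim (x≢y x≡y)
    ∏[]-remove h {x} (y ∷ ys) (there x∈) | no _   =
      trans (*-congˡ (∏[]-remove h ys x∈)) (solve 3 (λ a b c → a :* (b :* c) := b :* (a :* c)) refl _ _ _)

    ∏[]-⊆ : ∀ h xs ys → Unique xs → Unique ys → length xs ≡ length ys → (∀ {x} → x ∈ xs → x ∈ ys) → ∏[ h ] xs ≈ ∏[ h ] ys
    ∏[]-⊆ h []       []  _          _   _   _   = refl
    ∏[]-⊆ h (x ∷ xs) ys  (x∉ ∷ uxs) uys len xs⊆ys = begin
      h x * ∏[ h ] xs              ≈⟨ *-congˡ (∏[]-⊆ h xs (remove x ys) uxs (unique-remove x ys uys)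
                                        (ℕ.suc-injective (≡.trans len (≡.sym (length-remove ys x∈ys))))
                                        (λ z∈ → ∈-remove ys (xs⊆ys (there z∈)) (λ z≡x → All⇒∈ xs x∉ z∈ (≡.sym z≡x)))) ⟩
      h x * ∏[ h ] (remove x ys)   ≈⟨ ∏[]-remove h ys x∈ys ⟨
      ∏[ h ] ys                    ∎
      where
      x∈ys : x ∈ ys
      x∈ys = xs⊆ys (here ≡.refl)

  ∏[]-reindex : ∀ h (f : ℕ → ℕ) xs → Unique xs → (∀ {x} → x ∈ xs → f x ∈ xs) →
                (∀ {x y} → x ∈ xs → y ∈ xs → f x ≡ f y → x ≡ y) → ∏[ h ∘ f ] xs ≈ ∏[ h ] xs
  ∏[]-reindex h f xs uxs f∈ inj = begin
    ∏[ h ∘ f ] xs     ≡⟨ ∏[]-map h f xs ⟨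
    ∏[ h ] (map f xs) ≈⟨ ∏[]-⊆ h (map f xs) xs (unique-map f xs uxs inj) uxs (List.length-map f xs)
                           (λ z∈ → let w , w∈ , z≡fw = ∈-map⁻ f xs z∈ in ≡.subst (_∈ xs) (≡.sym z≡fw) (f∈ w∈)) ⟩
    ∏[ h ] xs         ∎

  ∏-∏[]-comm : ∀ n (H : ℕ → ℕ → Carrier) xs → ∏[ (λ u → ∏ n (λ l → H l u)) ] xs ≈ ∏ n (λ l → ∏[ H l ] xs)
  ∏-∏[]-comm n H []       = sym (∏-1 n)
  ∏-∏[]-comm n H (x ∷ xs) = trans (*-congˡ (∏-∏[]-comm n H xs)) (sym (∏-* n _ _))

  prodCoprime≈∏[coprimesTo] : ∀ p n f → prodCoprime p n f ≈ ∏[ f ] (coprimesTo p n)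
  prodCoprime≈∏[coprimesTo] p zero    f = refl
  prodCoprime≈∏[coprimesTo] p (suc n) f with p ∣? suc n
  ... | yes _ = prodCoprime≈∏[coprimesTo] p n f
  ... | no _  = *-congˡ (prodCoprime≈∏[coprimesTo] p n f)

  prodCoprime-cong : ∀ p n {f h} → (∀ k → f k ≈ h k) → prodCoprime p n f ≈ prodCoprime p n h
  prodCoprime-cong p zero    f≈h = refl
  prodCoprime-cong p (suc n) f≈h with p ∣? suc n
  ... | yes _ = prodCoprime-cong p n f≈h
  ... | no _  = *-cong (f≈h (suc n)) (prodCoprime-cong p n f≈h)

  prodCoprime-suc-∣ : ∀ p n f → p ℕ.∣ suc n → prodCoprime p (suc n) f ≈ prodCoprime p n f
  prodCoprime-suc-∣ p n f p∣n with p ∣? suc n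
  ... | yes _   = refl
  ... | no p∤n  = ⊥-elim (p∤n p∣n)

  prodCoprime-suc-∤ : ∀ p n f → ¬ (p ℕ.∣ suc n) → prodCoprime p (suc n) f ≈ f (suc n) * prodCoprime p n f
  prodCoprime-suc-∤ p n f p∤n with p ∣? suc n
  ... | yes p∣n = ⊥-elim (p∤n p∣n)
  ... | no _    = refl

  prodCoprime-< : ∀ p (f : ℕ → Carrier) k → k < p → prodCoprime p k f ≈ ∏ k (f ∘ suc)
  prodCoprime-< p f zero    _   = refl
  prodCoprime-< p f (suc k) k<p =
    trans (prodCoprime-suc-∤ p k f (>⇒∤ k<p)) (*-congˡ (prodCoprime-< p f k (ℕ.<-trans (ℕ.n<1+n k) k<p)))

  prodCoprime-self : ∀ q (f : ℕ → Carrier) → prodCoprime (suc q) (suc q) f ≈ ∏ q (f ∘ suc)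
  prodCoprime-self q f = trans (prodCoprime-suc-∣ (suc q) q f ∣-refl) (prodCoprime-< (suc q) f q ℕ.≤-refl)

  prodCoprime-+ : ∀ p a → p ℕ.∣ a → ∀ b f → prodCoprime p (b ℕ.+ a) f ≈ prodCoprime p b (λ u → f (a ℕ.+ u)) * prodCoprime p a f
  prodCoprime-+ p a p∣a zero    f = sym (*-identityˡ _)
  prodCoprime-+ p a p∣a (suc b) f with p ∣? suc (b ℕ.+ a) | p ∣? suc b
  ... | yes _    | yes _    = prodCoprime-+ p a p∣a b f
  ... | no _     | no _     = trans (*-cong (reflexive (≡.cong f (ℕ.+-comm (suc b) a))) (prodCoprime-+ p a p∣a b f)) (sym (*-assoc _ _ _))
  ... | yes p∣ba | no p∤b   = ⊥-elim (p∤b (∣m+n∣m⇒∣n (≡.subst (p ℕ.∣_) (ℕ.+-comm (suc b) a) p∣ba) p∣a))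
  ... | no p∤ba  | yes p∣b  = ⊥-elim (p∤ba (∣m∣n⇒∣m+n p∣b p∣a))

  prodCoprime-blocks : ∀ p M → p ℕ.∣ M → ∀ l f → prodCoprime p (l ℕ.* M) f ≈ ∏ l (λ i → prodCoprime p M (λ u → f (i ℕ.* M ℕ.+ u)))
  prodCoprime-blocks p M p∣M zero    f = refl
  prodCoprime-blocks p M p∣M (suc l) f = trans (prodCoprime-+ p (l ℕ.* M) (∣n⇒∣m*n l p∣M) M f) (*-congˡ (prodCoprime-blocks p M p∣M l f))

  prodCoprime-reindex-* : ∀ {p} → Prime p → ∀ e .{{_ : ℕ.NonZero (p ℕ.^ suc e)}} k → ¬ (p ℕ.∣ k) → (h : ℕ → Carrier) →
                          prodCoprime p (p ℕ.^ suc e) (λ u → h ((k ℕ.* u) % (p ℕ.^ suc e))) ≈ prodCoprime p (p ℕ.^ suc e) h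
  prodCoprime-reindex-* {p} pr e k p∤k h = begin
    prodCoprime p M (h ∘ f)       ≈⟨ prodCoprime≈∏[coprimesTo] p M (h ∘ f) ⟩
    ∏[ h ∘ f ] (coprimesTo p M)   ≈⟨ ∏[]-reindex h f (coprimesTo p M) (unique-coprimesTo p M) f∈ f-injective ⟩
    ∏[ h ] (coprimesTo p M)       ≈⟨ prodCoprime≈∏[coprimesTo] p M h ⟨
    prodCoprime p M h             ∎
    where
    M : ℕ
    M = p ℕ.^ suc e
    f : ℕ → ℕ
    f u = (k ℕ.* u) % M
    p∣M : p ℕ.∣ M
    p∣M = m∣m*n (p ℕ.^ e)
    <M : ∀ {x} → x ∈ coprimesTo p M → x < M
    <M x∈ = let _ , x≤M , p∤x = ∈-coprimesTo⁻ {p} {M} x∈ in ℕ.≤∧≢⇒< x≤M (λ x≡M → p∤x (≡.subst (p ℕ.∣_) (≡.sym x≡M) p∣M))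
    f∈ : ∀ {x} → x ∈ coprimesTo p M → f x ∈ coprimesTo p M
    f∈ {x} x∈ = ∈-coprimesTo (positive (f x) p∤fx) (ℕ.<⇒≤ (m%n<n (k ℕ.* x) M)) p∤fx
      where
      p∤fx : ¬ (p ℕ.∣ f x)
      p∤fx p∣fx = [ p∤k , proj₂ (proj₂ (∈-coprimesTo⁻ {p} {M} x∈)) ]′ (euclidsLemma k x pr (∣n∣m%n⇒∣m p∣M p∣fx))
      positive : ∀ r → ¬ (p ℕ.∣ r) → 0 < r
      positive zero    p∤0 = ⊥-elim (p∤0 (p ∣0))
      positive (suc r) _   = s≤s z≤n
    f-injective : ∀ {x y} → x ∈ coprimesTo p M → y ∈ coprimesTo p M → f x ≡ f y → x ≡ y
    f-injective x∈ y∈ = affine-%-injective M 0 k (prime⇒unitMod-^ pr p∤k (suc e)) (<M x∈) (<M y∈)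

-- Roots of unity of prime order

module PrimeRootOfUnity {c ℓ} (R : CommutativeRing c ℓ) (D : Cast.IsChar0Domain R)
  (n : ℕ) (pr : Prime (2 ℕ.+ n)) (ω : CommutativeRing.Carrier R)
  (prim : Cast.IsPrimitiveRoot R (2 ℕ.+ n) ω) where
  open CommutativeRing R
  open PolyOps R
  open Cast R
  open IntCast R
  open RingLemmas R
  open Char0Domain R D
  open IndexedProducts R
  open import Algebra.Properties.Group +-group using (x∙y⁻¹≈ε⇒x≈y)
  open import Relation.Binary.Reasoning.Setoid setoid

  p : ℕ
  p = 2 ℕ.+ n

  ωᵖ≈1 : pow ω p ≈ 1#
  ωᵖ≈1 = proj₁ prim

  pow-%p : ∀ k → pow ω k ≈ pow ω (k % p)
  pow-%p = pow-% ω p ωᵖ≈1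

  pow≉1 : ∀ k → ¬ (p ℕ.∣ k) → ¬ (pow ω k ≈ 1#)
  pow≉1 k p∤k ωᵏ≈1 with k % p in k%p≡r
  ... | zero  = p∤k (m%n≡0⇒n∣m k p k%p≡r)
  ... | suc r = proj₂ prim (suc r) (s≤s z≤n) (≡.subst (_< p) k%p≡r (m%n<n k p))
                  (trans (sym (reflexive (≡.cong (pow ω) k%p≡r))) (trans (sym (pow-%p k)) ωᵏ≈1))

  pow≈1 : ∀ k → p ℕ.∣ k → pow ω k ≈ 1#
  pow≈1 k (divides q ≡.refl) = pow-multiple ω p ωᵖ≈1 q

  ∑-geometric : ∀ y m → ∑ m (pow y) * (y - 1#) ≈ pow y m - 1#
  ∑-geometric y zero    = trans (zeroˡ _) (sym (-‿inverseʳ _))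
  ∑-geometric y (suc m) = begin
    (pow y m + ∑ m (pow y)) * (y - 1#)           ≈⟨ distribʳ _ _ _ ⟩
    pow y m * (y - 1#) + ∑ m (pow y) * (y - 1#)  ≈⟨ +-congˡ (∑-geometric y m) ⟩
    pow y m * (y - 1#) + (pow y m - 1#)          ≈⟨ solve 3 (λ a y o → a :* (y :- o) :+ (a :- o) := y :* a :- o :+ (a :- a :* o)) refl (pow y m) y 1# ⟩
    pow y (suc m) - 1# + (pow y m - pow y m * 1#) ≈⟨ +-congˡ (trans (+-congˡ (-‿cong (*-identityʳ _))) (-‿inverseʳ _)) ⟩
    pow y (suc m) - 1# + 0#                      ≈⟨ +-identityʳ _ ⟩
    pow y (suc m) - 1#                           ∎

  ∑-root-multiple : ∀ w → p ℕ.∣ w → ∑ p (λ k → pow ω (k ℕ.* w)) ≈ natCast p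
  ∑-root-multiple w p∣w = trans (∑-cong p (λ k _ → trans (pow-pow ω w k) (trans (pow-cong k (pow≈1 w p∣w)) (pow-1# k)))) (∑-1 p)

  ∑-root-nonmultiple : ∀ w → ¬ (p ℕ.∣ w) → ∑ p (λ k → pow ω (k ℕ.* w)) ≈ 0#
  ∑-root-nonmultiple w p∤w = *≈0⇒≈0 (begin
      (pow ω w - 1#) * ∑ p (λ k → pow ω (k ℕ.* w))   ≈⟨ *-comm _ _ ⟩
      ∑ p (λ k → pow ω (k ℕ.* w)) * (pow ω w - 1#)   ≈⟨ *-congʳ (∑-cong p (λ k _ → pow-pow ω w k)) ⟩
      ∑ p (pow (pow ω w)) * (pow ω w - 1#)           ≈⟨ ∑-geometric (pow ω w) p ⟩
      pow (pow ω w) p - 1#                           ≈⟨ +-congʳ (trans (pow-comm ω w p) (pow-cong w ωᵖ≈1)) ⟩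
      pow 1# w - 1#                                  ≈⟨ trans (+-congʳ (pow-1# w)) (-‿inverseʳ _) ⟩
      0#                                             ∎)
    (λ ωʷ-1≈0 → pow≉1 w p∤w (x∙y⁻¹≈ε⇒x≈y _ _ ωʷ-1≈0))

  ∏-reindex-affine : ∀ (h : ℕ → Carrier) c k → UnitMod p k → ∏ p (λ j → h ((c ℕ.+ k ℕ.* j) % p)) ≈ ∏ p h
  ∏-reindex-affine h c k unit = begin
    ∏ p (h ∘ f)           ≡⟨ ∏≡∏[range] p (h ∘ f) ⟩
    ∏[ h ∘ f ] (range p)  ≈⟨ ∏[]-reindex h f (range p) (unique-range p) (λ {x} _ → ∈-range (m%n<n (c ℕ.+ k ℕ.* x) p))
                                (λ x∈ y∈ → affine-%-injective p c k unit (∈-range⁻ x∈) (∈-range⁻ y∈)) ⟩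
    ∏[ h ] (range p)      ≡⟨ ∏≡∏[range] p h ⟨
    ∏ p h                 ∎
    where
    f : ℕ → ℕ
    f j = (c ℕ.+ k ℕ.* j) % p

  module _ (h : Carrier → Carrier) (h-cong : ∀ {x y} → x ≈ y → h x ≈ h y) where

    ∏-reindex-* : ∀ k → ¬ (p ℕ.∣ k) → ∏ p (λ j → h (pow ω (k ℕ.* j))) ≈ ∏ p (λ j → h (pow ω j))
    ∏-reindex-* k p∤k = trans (∏-cong p (λ j → h-cong (pow-%p (k ℕ.* j))))
      (∏-reindex-affine (h ∘ pow ω) 0 k (prime⇒unitMod pr p∤k))

    ∏-reindex-suc : ∏ p (λ j → h (pow ω (suc j))) ≈ ∏ p (λ j → h (pow ω j))
    ∏-reindex-suc = trans (∏-cong p (λ j → h-cong (trans (reflexive (≡.cong (pow ω ∘ suc) (≡.sym (ℕ.*-identityˡ j)))) (pow-%p (1 ℕ.+ 1 ℕ.* j)))))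
      (∏-reindex-affine (h ∘ pow ω) 1 1 (unitMod-1 p))

-- Polynomial rings

module PolyRing {c ℓ} (R : CommutativeRing c ℓ) (D : Cast.IsChar0Domain R) where
  open CommutativeRing R
  open PolyOps R
  open RingLemmas R
  open Eval R
  open Char0Domain R D using (eval≈⇒≈ₚ)

  private
    eval⊕ : ∀ P Q {x a b} → eval P x ≈ a → eval Q x ≈ b → eval (P ⊕ Q) x ≈ a + b
    eval⊕ P Q Pa Qb = trans (eval-⊕ P Q _) (+-cong Pa Qb)

    eval⊗ : ∀ P Q {x a b} → eval P x ≈ a → eval Q x ≈ b → eval (P ⊗ Q) x ≈ a * b
    eval⊗ P Q Pa Qb = trans (eval-⊗ P Q _) (*-cong Pa Qb)

    by-eval : ∀ P Q {f : Carrier → Carrier} → (∀ x → eval P x ≈ f x) → (∀ x → eval Q x ≈ f x) → P ≈ₚ Q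
    by-eval P Q Pf Qf = eval≈⇒≈ₚ P Q (λ x → trans (Pf x) (sym (Qf x)))

    ⊕-cong : ∀ {P P′ Q Q′} → P ≈ₚ P′ → Q ≈ₚ Q′ → (P ⊕ Q) ≈ₚ (P′ ⊕ Q′)
    ⊕-cong {P} {P′} {Q} {Q′} P≈ Q≈ = by-eval (P ⊕ Q) (P′ ⊕ Q′)
      (λ x → eval⊕ P Q (eval-cong P P′ x P≈) (eval-cong Q Q′ x Q≈)) (λ x → eval-⊕ P′ Q′ x)

    ⊗-cong : ∀ {P P′ Q Q′} → P ≈ₚ P′ → Q ≈ₚ Q′ → (P ⊗ Q) ≈ₚ (P′ ⊗ Q′)
    ⊗-cong {P} {P′} {Q} {Q′} P≈ Q≈ = by-eval (P ⊗ Q) (P′ ⊗ Q′)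
      (λ x → eval⊗ P Q (eval-cong P P′ x P≈) (eval-cong Q Q′ x Q≈)) (λ x → eval-⊗ P′ Q′ x)

    neg-cong : ∀ {P Q} → P ≈ₚ Q → neg P ≈ₚ neg Q
    neg-cong {P} {Q} P≈Q = by-eval (neg P) (neg Q) (λ x → trans (eval-neg P x) (-‿cong (eval-cong P Q x P≈Q))) (λ x → eval-neg Q x)

  R[X] : CommutativeRing c ℓ
  R[X] = record
    { Carrier = Poly ; _≈_ = _≈ₚ_ ; _+_ = _⊕_ ; _*_ = _⊗_ ; -_ = neg ; 0# = [] ; 1# = const 1#
    ; isCommutativeRing = record
      { isRing = record
        { +-isAbelianGroup = record
          { isGroup = record
            { isMonoid = record
              { isSemigroup = record
                { isMagma = record
                  { isEquivalence = record { refl = λ {P} → ≈ₚ-refl {P} ; sym = λ {P} {Q} → ≈ₚ-sym {P} {Q} ; trans = λ {P} {Q} {S} → ≈ₚ-trans {P} {Q} {S} }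
                  ; ∙-cong = λ {P} {P′} {Q} {Q′} → ⊕-cong {P} {P′} {Q} {Q′} }
                ; assoc = λ P Q S → by-eval ((P ⊕ Q) ⊕ S) (P ⊕ (Q ⊕ S))
                    (λ x → eval⊕ (P ⊕ Q) S (eval-⊕ P Q x) refl) (λ x → trans (eval⊕ P (Q ⊕ S) refl (eval-⊕ Q S x)) (sym (+-assoc _ _ _))) }
              ; identity = (λ P → ≈ₚ-refl {P}) , (λ P → by-eval (P ⊕ []) P (λ x → trans (eval-⊕ P [] x) (+-identityʳ _)) (λ x → refl)) }
            ; inverse = (λ P → by-eval (neg P ⊕ P) [] (λ x → trans (eval⊕ (neg P) P (eval-neg P x) refl) (-‿inverseˡ _)) (λ x → refl))
                      , (λ P → by-eval (P ⊕ neg P) [] (λ x → trans (eval⊕ P (neg P) refl (eval-neg P x)) (-‿inverseʳ _)) (λ x → refl))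
            ; ⁻¹-cong = λ {P} {Q} → neg-cong {P} {Q} }
          ; comm = λ P Q → by-eval (P ⊕ Q) (Q ⊕ P) (λ x → eval-⊕ P Q x) (λ x → trans (eval-⊕ Q P x) (+-comm _ _)) }
        ; *-cong = λ {P} {P′} {Q} {Q′} → ⊗-cong {P} {P′} {Q} {Q′}
        ; *-assoc = λ P Q S → by-eval ((P ⊗ Q) ⊗ S) (P ⊗ (Q ⊗ S))
            (λ x → eval⊗ (P ⊗ Q) S (eval-⊗ P Q x) refl) (λ x → trans (eval⊗ P (Q ⊗ S) refl (eval-⊗ Q S x)) (sym (*-assoc _ _ _)))
        ; *-identity = (λ P → by-eval (const 1# ⊗ P) P (λ x → trans (eval⊗ (const 1#) P (eval-const 1# x) refl) (*-identityˡ _)) (λ x → refl))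
                     , (λ P → by-eval (P ⊗ const 1#) P (λ x → trans (eval⊗ P (const 1#) refl (eval-const 1# x)) (*-identityʳ _)) (λ x → refl))
        ; distrib = (λ P Q S → by-eval (P ⊗ (Q ⊕ S)) (P ⊗ Q ⊕ P ⊗ S)
                       (λ x → trans (eval⊗ P (Q ⊕ S) refl (eval-⊕ Q S x)) (distribˡ _ _ _)) (λ x → eval⊕ (P ⊗ Q) (P ⊗ S) (eval-⊗ P Q x) (eval-⊗ P S x)))
                  , (λ P Q S → by-eval ((Q ⊕ S) ⊗ P) (Q ⊗ P ⊕ S ⊗ P)
                       (λ x → trans (eval⊗ (Q ⊕ S) P (eval-⊕ Q S x) refl) (distribʳ _ _ _)) (λ x → eval⊕ (Q ⊗ P) (S ⊗ P) (eval-⊗ Q P x) (eval-⊗ S P x))) }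
      ; *-comm = λ P Q → by-eval (P ⊗ Q) (Q ⊗ P) (λ x → eval-⊗ P Q x) (λ x → trans (eval-⊗ Q P x) (*-comm _ _)) } }

natCast≡+ : ∀ n → Cast.natCast ℤring n ≡ + n
natCast≡+ zero    = ≡.refl
natCast≡+ (suc n) = ≡.cong (ℤ._+_ (+ 1)) (natCast≡+ n)

ι≡id : ∀ z → Cast.ι ℤring z ≡ z
ι≡id (+ n)    = natCast≡+ n
ι≡id -[1+ n ] = ≡.cong ℤ.-_ (natCast≡+ (suc n))

ℤ-isChar0Domain : Cast.IsChar0Domain ℤring
ℤ-isChar0Domain = record
  { char0 = λ n ιn≡0 → ≡.trans (≡.sym (ι≡id n)) ιn≡0
  ; noZeroDivs = λ a b ab≡0 → ℤ.i*j≡0⇒i≡0∨j≡0 a ab≡0 }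

ℤ[X] : CommutativeRing _ _
ℤ[X] = PolyRing.R[X] ℤring ℤ-isChar0Domain

-- The Frobenius congruence

[1+k]*[1+n]C[1+k]≡[1+n]*nCk : ∀ n k → suc k ℕ.* (suc n C suc k) ≡ suc n ℕ.* (n C k)
[1+k]*[1+n]C[1+k]≡[1+n]*nCk zero    zero    = ≡.refl
[1+k]*[1+n]C[1+k]≡[1+n]*nCk zero    (suc k) = ℕ.*-zeroʳ (suc (suc k))
[1+k]*[1+n]C[1+k]≡[1+n]*nCk (suc n) zero    = ≡.trans (ℕ.*-identityˡ _) (≡.trans (nC1≡n (suc (suc n))) (≡.sym (ℕ.*-identityʳ (suc (suc n)))))
[1+k]*[1+n]C[1+k]≡[1+n]*nCk (suc n) (suc k) = begin
  suc (suc k) ℕ.* (suc (suc n) C suc (suc k))                               ≡⟨ ≡.cong (suc (suc k) ℕ.*_) (nCk+nC[k+1]≡[n+1]C[k+1] (suc n) (suc k)) ⟨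
  suc (suc k) ℕ.* (suc n C suc k ℕ.+ suc n C suc (suc k))                   ≡⟨ ℕ.*-distribˡ-+ (suc (suc k)) (suc n C suc k) _ ⟩
  (suc n C suc k ℕ.+ suc k ℕ.* (suc n C suc k)) ℕ.+ suc (suc k) ℕ.* (suc n C suc (suc k))
    ≡⟨ ≡.cong₂ (λ a b → suc n C suc k ℕ.+ a ℕ.+ b) ([1+k]*[1+n]C[1+k]≡[1+n]*nCk n k) ([1+k]*[1+n]C[1+k]≡[1+n]*nCk n (suc k)) ⟩
  suc n C suc k ℕ.+ suc n ℕ.* (n C k) ℕ.+ suc n ℕ.* (n C suc k)             ≡⟨ ℕ.+-assoc (suc n C suc k) _ _ ⟩
  suc n C suc k ℕ.+ (suc n ℕ.* (n C k) ℕ.+ suc n ℕ.* (n C suc k))           ≡⟨ ≡.cong (suc n C suc k ℕ.+_) (ℕ.*-distribˡ-+ (suc n) (n C k) _) ⟨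
  suc n C suc k ℕ.+ suc n ℕ.* (n C k ℕ.+ n C suc k)                         ≡⟨ ≡.cong (λ t → suc n C suc k ℕ.+ suc n ℕ.* t) (nCk+nC[k+1]≡[n+1]C[k+1] n k) ⟩
  suc (suc n) ℕ.* (suc n C suc k)                                           ∎
  where open ≡.≡-Reasoning

prime∣C : ∀ {n} → Prime (suc n) → ∀ k → suc k < suc n → suc n ℕ.∣ (suc n C suc k)
prime∣C {n} pr k k<n with euclidsLemma (suc k) (suc n C suc k) pr
                             (divides (n C k) (≡.trans ([1+k]*[1+n]C[1+k]≡[1+n]*nCk n k) (ℕ.*-comm (suc n) (n C k))))
... | inj₁ p∣k+1 = ⊥-elim (>⇒∤ k<n p∣k+1)
... | inj₂ p∣C   = p∣C

module Frobenius {a ℓ} (S : CommutativeRing a ℓ) (m : ℕ) (pr : Prime (2 ℕ.+ m)) where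
  open CommutativeRing S
  open import Algebra.Properties.Semiring.Exp semiring using (_^_)
  open import Algebra.Properties.Semiring.Mult semiring using () renaming (_×_ to _·_)
  open import Algebra.Properties.Monoid.Mult +-monoid using (×-assocˡ)
  open import Algebra.Properties.CommutativeMonoid.Mult +-commutativeMonoid using (×-distrib-+)
  open import Algebra.Properties.CommutativeSemiring.Binomial commutativeSemiring using (theorem; binomialTerm; binomial)
  open import Algebra.Properties.Monoid.Sum +-monoid using (sum; sum-init-last; sum-cong-≋)
  open import Relation.Binary.Reasoning.Setoid setoid

  private
    p : ℕ
    p = 2 ℕ.+ m

    ·-zeroʳ : ∀ k → k · 0# ≈ 0#
    ·-zeroʳ zero    = refl
    ·-zeroʳ (suc k) = trans (+-identityˡ _) (·-zeroʳ k)

    sum-· : ∀ k (f : Fin k → Carrier) → sum (λ i → p · f i) ≈ p · sum f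
    sum-· zero    f = sym (·-zeroʳ p)
    sum-· (suc k) f = trans (+-congˡ (sum-· k (f ∘ Fin.suc))) (sym (×-distrib-+ (f Fin.zero) (sum (f ∘ Fin.suc)) p))

  frobenius : ∀ x y → Σ Carrier (λ z → (x + y) ^ p ≈ (x ^ p + y ^ p) + p · z)
  frobenius x y = sum middle/p , (begin
      (x + y) ^ p                                          ≈⟨ theorem p x y ⟩
      t Fin.zero + sum (t ∘ Fin.suc)                       ≈⟨ +-cong (trans (+-identityʳ _) (*-identityˡ _)) (sum-init-last (t ∘ Fin.suc)) ⟩
      y ^ p + (sum (λ i → t (Fin.suc (inject₁ i))) + t (Fin.suc (fromℕ (suc m))))
                                                           ≈⟨ +-congˡ (+-cong (trans (sum-cong-≋ middle) (sum-· (suc m) middle/p)) last) ⟩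
      y ^ p + (p · sum middle/p + x ^ p)                   ≈⟨ solve-+ ⟩
      (x ^ p + y ^ p) + p · sum middle/p                   ∎)
    where
    t : Fin (suc p) → Carrier
    t = binomialTerm x y p

    p∣C : (i : Fin (suc m)) → p ℕ.∣ (p C suc (toℕ i))
    p∣C i = prime∣C pr (toℕ i) (s≤s (Fin.toℕ<n i))

    middle/p : Fin (suc m) → Carrier
    middle/p i = quotient (p∣C i) · binomial x y p (Fin.suc (inject₁ i))

    middle : ∀ i → t (Fin.suc (inject₁ i)) ≈ p · middle/p i
    middle i with p∣C i
    ... | divides q C≡qp = begin
      (p C toℕ (Fin.suc (inject₁ i))) · b  ≡⟨ ≡.cong (λ k → (p C suc k) · b) (Fin.toℕ-inject₁ i) ⟩
      (p C suc (toℕ i)) · b                ≡⟨ ≡.cong (_· b) (≡.trans C≡qp (ℕ.*-comm q p)) ⟩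
      (p ℕ.* q) · b                        ≈⟨ ×-assocˡ b p q ⟨
      p · (q · b)                          ∎
      where b = binomial x y p (Fin.suc (inject₁ i))

    last : t (Fin.suc (fromℕ (suc m))) ≈ x ^ p
    last = begin
      (p C toℕ (Fin.suc (fromℕ (suc m)))) · (x ^ toℕ (Fin.suc (fromℕ (suc m))) * y ^ (p ℕ.∸ toℕ (Fin.suc (fromℕ (suc m)))))
        ≡⟨ ≡.cong (λ k → (p C suc k) · (x ^ suc k * y ^ (p ℕ.∸ suc k))) (Fin.toℕ-fromℕ (suc m)) ⟩
      (p C p) · (x ^ p * y ^ (p ℕ.∸ p))  ≡⟨ ≡.cong₂ (λ c e → c · (x ^ p * y ^ e)) (nCn≡1 p) (ℕ.n∸n≡0 p) ⟩
      1 · (x ^ p * 1#)                    ≈⟨ trans (+-identityʳ _) (*-identityʳ _) ⟩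
      x ^ p                               ∎

    solve-+ : y ^ p + (p · sum middle/p + x ^ p) ≈ (x ^ p + y ^ p) + p · sum middle/p
    solve-+ = trans (+-congˡ (+-comm _ _)) (trans (sym (+-assoc _ _ _)) (+-congʳ (+-comm _ _)))

infix 4 _≡_[mod_]
record _≡_[mod_] (a b : ℤ) (p : ℕ) : Set where
  constructor byMultiple
  field
    multiple : ℤ
    difference : a ≡ b ℤ.+ + p ℤ.* multiple

module _ {p : ℕ} where

  ≡⇒≡[mod] : ∀ {a b} → a ≡ b → a ≡ b [mod p ]
  ≡⇒≡[mod] {b = b} ≡.refl = byMultiple (+ 0) (lemma b (+ p))
    where
    lemma : ∀ b p → b ≡ b ℤ.+ p ℤ.* + 0
    lemma = solve-∀

  ≡[mod]-trans : ∀ {a b c} → a ≡ b [mod p ] → b ≡ c [mod p ] → a ≡ c [mod p ]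
  ≡[mod]-trans {c = c} (byMultiple u ≡.refl) (byMultiple v ≡.refl) = byMultiple (v ℤ.+ u) (lemma c (+ p) u v)
    where
    lemma : ∀ c p u v → (c ℤ.+ p ℤ.* v) ℤ.+ p ℤ.* u ≡ c ℤ.+ p ℤ.* (v ℤ.+ u)
    lemma = solve-∀

  ≡[mod]-sym : ∀ {a b} → a ≡ b [mod p ] → b ≡ a [mod p ]
  ≡[mod]-sym {b = b} (byMultiple u ≡.refl) = byMultiple (ℤ.- u) (lemma b (+ p) u)
    where
    lemma : ∀ b p u → b ≡ (b ℤ.+ p ℤ.* u) ℤ.+ p ℤ.* ℤ.- u
    lemma = solve-∀

  ≡[mod]-+ : ∀ {a b c d} → a ≡ b [mod p ] → c ≡ d [mod p ] → a ℤ.+ c ≡ b ℤ.+ d [mod p ]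
  ≡[mod]-+ {b = b} {d = d} (byMultiple u ≡.refl) (byMultiple v ≡.refl) = byMultiple (u ℤ.+ v) (lemma b d (+ p) u v)
    where
    lemma : ∀ b d p u v → (b ℤ.+ p ℤ.* u) ℤ.+ (d ℤ.+ p ℤ.* v) ≡ (b ℤ.+ d) ℤ.+ p ℤ.* (u ℤ.+ v)
    lemma = solve-∀

  ≡[mod]⇒∣- : ∀ {a b} → a ≡ b [mod p ] → + p ∣ a ℤ.- b
  ≡[mod]⇒∣- {b = b} (byMultiple u ≡.refl) = divides ℤ.∣ u ∣ (begin
      ℤ.∣ b ℤ.+ + p ℤ.* u ℤ.- b ∣   ≡⟨ ≡.cong ℤ.∣_∣ (lemma b (+ p) u) ⟩
      ℤ.∣ + p ℤ.* u ∣               ≡⟨ ℤ.abs-* (+ p) u ⟩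
      p ℕ.* ℤ.∣ u ∣                 ≡⟨ ℕ.*-comm p ℤ.∣ u ∣ ⟩
      ℤ.∣ u ∣ ℕ.* p                 ∎)
    where
    open ≡.≡-Reasoning
    lemma : ∀ b p u → b ℤ.+ p ℤ.* u ℤ.- b ≡ p ℤ.* u
    lemma = solve-∀

module Fermat (m : ℕ) (pr : Prime (2 ℕ.+ m)) where
  open Frobenius ℤring m pr
  open import Algebra.Properties.Semiring.Exp (CommutativeRing.semiring ℤring) using (_^_)
  open import Algebra.Properties.Semiring.Mult (CommutativeRing.semiring ℤring) using () renaming (_×_ to _·_)

  p : ℕ
  p = 2 ℕ.+ m

  ·≡* : ∀ k z → k · z ≡ + k ℤ.* z
  ·≡* zero    z = ≡.sym (ℤ.*-zeroˡ z)
  ·≡* (suc k) z = ≡.trans (≡.cong (ℤ._+_ z) (·≡* k z)) (≡.sym (≡.trans (ℤ.*-distribʳ-+ z (+ 1) (+ k)) (≡.cong (ℤ._+ (+ k ℤ.* z)) (ℤ.*-identityˡ z))))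

  frobeniusℤ : ∀ x y → (x ℤ.+ y) ^ p ≡ x ^ p ℤ.+ y ^ p [mod p ]
  frobeniusℤ x y = let z , eq = frobenius x y in byMultiple z (≡.trans eq (≡.cong (ℤ._+_ (x ^ p ℤ.+ y ^ p)) (·≡* p z)))

  private
    1^ : ∀ k → (+ 1) ^ k ≡ + 1
    1^ zero    = ≡.refl
    1^ (suc k) = ≡.trans (ℤ.*-identityˡ _) (1^ k)

    fermat-ℕ : ∀ k → (+ k) ^ p ≡ + k [mod p ]
    fermat-ℕ zero    = ≡⇒≡[mod] ≡.refl
    fermat-ℕ (suc k) = ≡[mod]-trans (frobeniusℤ (+ 1) (+ k)) (≡[mod]-+ (≡⇒≡[mod] (1^ p)) (fermat-ℕ k))

  fermat : ∀ a → a ^ p ≡ a [mod p ]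
  fermat (+ k)    = fermat-ℕ k
  fermat -[1+ k ] = negate (frobeniusℤ -[1+ k ] (+ suc k)) (fermat-ℕ (suc k))
    where
    open ≡.≡-Reasoning
    split : ∀ a b c → a ≡ (a ℤ.+ b ℤ.+ c) ℤ.- b ℤ.- c
    split = solve-∀
    collect : ∀ k q u z → + 0 ℤ.- (k ℤ.+ q ℤ.* u) ℤ.- q ℤ.* z ≡ ℤ.- k ℤ.+ q ℤ.* ℤ.- (u ℤ.+ z)
    collect = solve-∀
    negate : (-[1+ k ] ℤ.+ + suc k) ^ p ≡ -[1+ k ] ^ p ℤ.+ (+ suc k) ^ p [mod p ] → (+ suc k) ^ p ≡ + suc k [mod p ] →
             -[1+ k ] ^ p ≡ -[1+ k ] [mod p ]
    negate (byMultiple z 0≡) (byMultiple u kᵖ≡) = byMultiple (ℤ.- (u ℤ.+ z)) (begin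
      -[1+ k ] ^ p                                                            ≡⟨ split (-[1+ k ] ^ p) ((+ suc k) ^ p) (+ p ℤ.* z) ⟩
      (-[1+ k ] ^ p ℤ.+ (+ suc k) ^ p ℤ.+ + p ℤ.* z) ℤ.- (+ suc k) ^ p ℤ.- + p ℤ.* z
        ≡⟨ ≡.cong₂ (λ s t → s ℤ.- t ℤ.- + p ℤ.* z) (≡.trans (≡.sym 0≡) (≡.cong (_^ p) (ℤ.+-inverseˡ (+ suc k)))) kᵖ≡ ⟩
      + 0 ℤ.- (+ suc k ℤ.+ + p ℤ.* u) ℤ.- + p ℤ.* z                           ≡⟨ collect (+ suc k) (+ p) u z ⟩
      -[1+ k ] ℤ.+ + p ℤ.* ℤ.- (u ℤ.+ z)                                      ∎)

module PolyFrobenius (m : ℕ) (pr : Prime (2 ℕ.+ m)) where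
  open Fermat m pr using (p; fermat)
  open PolyOps ℤring
  open RingLemmas ℤring
  open Eval ℤring
  open Char0Domain ℤring ℤ-isChar0Domain using (eval≈⇒≈ₚ)
  private
    module ℤ[X] = CommutativeRing ℤ[X]
  open Frobenius ℤ[X] m pr renaming (frobenius to frobenius[X])
  open import Algebra.Properties.Semiring.Exp (CommutativeRing.semiring ℤring) using (_^_)
  open import Algebra.Properties.Semiring.Exp ℤ[X].semiring using () renaming (_^_ to _^ₚ_)
  open import Algebra.Properties.Semiring.Mult ℤ[X].semiring using () renaming (_×_ to _·ₚ_)
  open ≡.≡-Reasoning

  private
    ^ₚ≡powₚ : ∀ A k → A ^ₚ k ≡ powₚ A k
    ^ₚ≡powₚ A zero    = ≡.refl
    ^ₚ≡powₚ A (suc k) = ≡.cong (A ⊗_) (^ₚ≡powₚ A k)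

    pow≡^ : ∀ a k → pow a k ≡ a ^ k
    pow≡^ a zero    = ≡.refl
    pow≡^ a (suc k) = ≡.cong (a ℤ.*_) (pow≡^ a k)

    coeff-·ₚ : ∀ k Z i → coeff (k ·ₚ Z) i ≡ + k ℤ.* coeff Z i
    coeff-·ₚ zero    Z i = ≡.sym (ℤ.*-zeroˡ (coeff Z i))
    coeff-·ₚ (suc k) Z i = begin
      coeff (Z ⊕ k ·ₚ Z) i                 ≡⟨ coeff-⊕ Z (k ·ₚ Z) i ⟩
      coeff Z i ℤ.+ coeff (k ·ₚ Z) i       ≡⟨ ≡.cong (ℤ._+_ (coeff Z i)) (coeff-·ₚ k Z i) ⟩
      coeff Z i ℤ.+ + k ℤ.* coeff Z i      ≡⟨ ≡.cong (ℤ._+ (+ k ℤ.* coeff Z i)) (ℤ.*-identityˡ (coeff Z i)) ⟨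
      + 1 ℤ.* coeff Z i ℤ.+ + k ℤ.* coeff Z i ≡⟨ ℤ.*-distribʳ-+ (coeff Z i) (+ 1) (+ k) ⟨
      + suc k ℤ.* coeff Z i                ∎

    powₚ-const : ∀ a → powₚ (const a) p ≈ₚ const (pow a p)
    powₚ-const a = eval≈⇒≈ₚ (powₚ (const a) p) (const (pow a p)) (λ x → begin
      eval (powₚ (const a) p) x   ≡⟨ eval-powₚ (const a) p x ⟩
      pow (eval (const a) x) p    ≡⟨ pow-cong p (eval-const a x) ⟩
      pow a p                     ≡⟨ eval-const (pow a p) x ⟨
      eval (const (pow a p)) x    ∎)

    powₚ-X⊗ : ∀ G → powₚ (X ⊗ G) p ≈ₚ (replicate p (+ 0) ++ powₚ G p)
    powₚ-X⊗ G = eval≈⇒≈ₚ (powₚ (X ⊗ G) p) (replicate p (+ 0) ++ powₚ G p) (λ x → begin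
      eval (powₚ (X ⊗ G) p) x                   ≡⟨ eval-powₚ (X ⊗ G) p x ⟩
      pow (eval (X ⊗ G) x) p                    ≡⟨ pow-cong p (≡.trans (eval-⊗ X G x) (≡.cong (ℤ._* eval G x) (eval-X x))) ⟩
      pow (x ℤ.* eval G x) p                    ≡⟨ pow-* x (eval G x) p ⟩
      pow x p ℤ.* pow (eval G x) p              ≡⟨ ≡.cong (pow x p ℤ.*_) (eval-powₚ G p x) ⟨
      pow x p ℤ.* eval (powₚ G p) x             ≡⟨ eval-shift p (powₚ G p) x ⟨
      eval (replicate p (+ 0) ++ powₚ G p) x    ∎)

    powₚ-∷ : ∀ a G → powₚ (a ∷ G) p ≈ₚ powₚ (const a ⊕ X ⊗ G) p
    powₚ-∷ a G = eval≈⇒≈ₚ (powₚ (a ∷ G) p) (powₚ (const a ⊕ X ⊗ G) p) (λ x → begin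
      eval (powₚ (a ∷ G) p) x                   ≡⟨ eval-powₚ (a ∷ G) p x ⟩
      pow (a ℤ.+ x ℤ.* eval G x) p              ≡⟨ pow-cong p (≡.cong₂ ℤ._+_ (eval-const a x) (≡.trans (eval-⊗ X G x) (≡.cong (ℤ._* eval G x) (eval-X x)))) ⟨
      pow (eval (const a) x ℤ.+ eval (X ⊗ G) x) p ≡⟨ pow-cong p (eval-⊕ (const a) (X ⊗ G) x) ⟨
      pow (eval (const a ⊕ X ⊗ G) x) p          ≡⟨ eval-powₚ (const a ⊕ X ⊗ G) p x ⟨
      eval (powₚ (const a ⊕ X ⊗ G) p) x         ∎)

    coeff-powₚ-∷ : ∀ a G i → coeff (powₚ (a ∷ G) p) i ≡ coeff (powₚ (const a) p) i ℤ.+ coeff (powₚ (X ⊗ G) p) i [mod p ]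
    coeff-powₚ-∷ a G i = let Z , eq = frobenius[X] (const a) (X ⊗ G) in byMultiple (coeff Z i) (begin
      coeff (powₚ (a ∷ G) p) i                                        ≡⟨ powₚ-∷ a G i ⟩
      coeff (powₚ (const a ⊕ X ⊗ G) p) i                              ≡⟨ ≡.cong (λ T → coeff T i) (^ₚ≡powₚ (const a ⊕ X ⊗ G) p) ⟨
      coeff ((const a ⊕ X ⊗ G) ^ₚ p) i                                ≡⟨ eq i ⟩
      coeff ((const a ^ₚ p ⊕ (X ⊗ G) ^ₚ p) ⊕ p ·ₚ Z) i                ≡⟨ ≡.cong₂ (λ A B → coeff ((A ⊕ B) ⊕ p ·ₚ Z) i) (^ₚ≡powₚ (const a) p) (^ₚ≡powₚ (X ⊗ G) p) ⟩
      coeff ((powₚ (const a) p ⊕ powₚ (X ⊗ G) p) ⊕ p ·ₚ Z) i          ≡⟨ coeff-⊕ (powₚ (const a) p ⊕ powₚ (X ⊗ G) p) (p ·ₚ Z) i ⟩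
      coeff (powₚ (const a) p ⊕ powₚ (X ⊗ G) p) i ℤ.+ coeff (p ·ₚ Z) i ≡⟨ ≡.cong₂ ℤ._+_ (coeff-⊕ (powₚ (const a) p) (powₚ (X ⊗ G) p) i) (coeff-·ₚ p Z i) ⟩
      coeff (powₚ (const a) p) i ℤ.+ coeff (powₚ (X ⊗ G) p) i ℤ.+ + p ℤ.* coeff Z i ∎)

  coeff-powₚ-p : ∀ F q → coeff (powₚ F p) (q ℕ.* p) ≡ coeff F q [mod p ]
  coeff-powₚ-p []      q       = ≡⇒≡[mod] ≡.refl
  coeff-powₚ-p (a ∷ G) zero    = ≡[mod]-trans (coeff-powₚ-∷ a G 0) (≡[mod]-trans
    (≡⇒≡[mod] (≡.cong₂ ℤ._+_ (≡.trans (powₚ-const a 0) (pow≡^ a p)) (≡.trans (powₚ-X⊗ G 0) (coeff-shift-< p (powₚ G p) 0 (s≤s z≤n)))))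
    (≡[mod]-trans (≡[mod]-+ (fermat a) (≡⇒≡[mod] {p = p} ≡.refl)) (≡⇒≡[mod] (ℤ.+-identityʳ a))))
  coeff-powₚ-p (a ∷ G) (suc q) = ≡[mod]-trans (coeff-powₚ-∷ a G (suc q ℕ.* p)) (≡[mod]-trans
    (≡⇒≡[mod] (≡.trans (≡.cong₂ ℤ._+_ (powₚ-const a (suc q ℕ.* p)) (≡.trans (powₚ-X⊗ G (p ℕ.+ q ℕ.* p)) (coeff-shift-+ p (powₚ G p) (q ℕ.* p))))
                       (ℤ.+-identityˡ _)))
    (coeff-powₚ-p G q))

-- The polynomial g

module NormPolynomial (n : ℕ) (F : ℤPoly) where
  p : ℕ
  p = 2 ℕ.+ n

  open PolyOps ℤ[X] public using () renaming (Poly to ℤ[T][X])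
  private
    module ℤ[T][X] = PolyOps ℤ[X]

  genericH : ℤ[T][X]
  genericH = ℤ[T][X].prodₚ p (λ j → ℤ[T][X].twist (ℤ[T][X].pow ℤP.X j) (map ℤP.const F))

  residueSum : ℕ → ℤPoly → ℤ
  residueSum w []      = + 0
  residueSum w (a ∷ c) = (if does (p ∣? w) then a else + 0) ℤ.+ residueSum (suc w) c

  gCoeff : ℕ → ℤ
  gCoeff m = residueSum 0 c ℤ.- residueSum (suc n) c
    where c = ℤ[T][X].coeff genericH m

  g : ℤPoly
  g = applyUpTo (λ q → gCoeff (q ℕ.* p)) (length genericH)

  coeff-g : ∀ q → ℤP.coeff g q ≡ gCoeff (q ℕ.* p)
  coeff-g q = coeff-applyUpTo (λ q → gCoeff (q ℕ.* p)) (length genericH) q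
    (λ len≤q → ≡.cong (λ c → residueSum 0 c ℤ.- residueSum (suc n) c)
                 (RingLemmas.coeff-beyond ℤ[X] genericH (q ℕ.* p) (ℕ.≤-trans len≤q (ℕ.m≤m*n q p))))
    where
    coeff-applyUpTo : ∀ f m q → (m ≤ q → f q ≡ + 0) → ℤP.coeff (applyUpTo f m) q ≡ f q
    coeff-applyUpTo f zero    q       beyond = ≡.sym (beyond ℕ.z≤n)
    coeff-applyUpTo f (suc m) zero    _      = ≡.refl
    coeff-applyUpTo f (suc m) (suc q) beyond = coeff-applyUpTo (f ∘ suc) m q (beyond ∘ s≤s)

module Construction {r ℓ} (R : CommutativeRing r ℓ) (D : Cast.IsChar0Domain R)
  (n : ℕ) (pr : Prime (2 ℕ.+ n)) (ω : CommutativeRing.Carrier R)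
  (prim : Cast.IsPrimitiveRoot R (2 ℕ.+ n) ω) (F : ℤPoly) where
  open CommutativeRing R
  open PolyOps R
  open Cast R
  open IntCast R
  open RingLemmas R
  open Eval R
  open Char0Domain R D
  open PrimeRootOfUnity R D n pr ω prim hiding (p)
  open NormPolynomial n F
  open EvalHom ℤring R ι using (IsRingHom; evalMap) public
  private
    module ℤ[T][X] = PolyOps ℤ[X]
    module ι = EvalHom ℤring R ι
    module ℤ[X] = CommutativeRing ℤ[X]
  open import Algebra.Properties.Group +-group using (x∙y⁻¹≈ε⇒x≈y)
  open import Relation.Binary.Reasoning.Setoid setoid

  ι-isRingHom : IsRingHom
  ι-isRingHom = record { φ-cong = λ a≡b → reflexive (≡.cong ι a≡b) ; φ-+ = ι-+ ; φ-* = ι-* ; φ-0 = refl ; φ-1 = ι-1 }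

  F[_] : Carrier → Carrier
  F[ y ] = evalMap F y

  F-cong : ∀ {x y} → x ≈ y → F[ x ] ≈ F[ y ]
  F-cong = eval-arg (ιₚ F)

  at : ℕ → ℤPoly → Carrier
  at k c = evalMap c (pow ω k)

  at-isRingHom : ∀ k → EvalHom.IsRingHom ℤ[X] R (at k)
  at-isRingHom k = record
    { φ-cong = λ {c} {d} → ι.evalMap-cong ι-isRingHom {c} {d} (pow ω k)
    ; φ-+ = λ c d → ι.evalMap-⊕ ι-isRingHom c d (pow ω k)
    ; φ-* = λ c d → ι.evalMap-⊗ ι-isRingHom c d (pow ω k)
    ; φ-0 = refl
    ; φ-1 = trans (ι.evalMap-const ι-isRingHom (+ 1) (pow ω k)) ι-1 }

  private
    module at (k : ℕ) = EvalHom ℤ[X] R (at k)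

  eval-genericH : ∀ k x → at.evalMap k genericH x ≈ ∏ p (λ j → F[ pow (pow ω k) j * x ])
  eval-genericH k x = begin
    at.evalMap k genericH x                                          ≈⟨ at.evalMap-prodₚ k (at-isRingHom k) p (λ j → ℤ[T][X].twist (ℤ[T][X].pow T j) Fᶜ) x ⟩
    ∏ p (λ j → at.evalMap k (ℤ[T][X].twist (ℤ[T][X].pow T j) Fᶜ) x) ≈⟨ ∏-cong p (λ j → at.evalMap-twist k (at-isRingHom k) (ℤ[T][X].pow T j) Fᶜ x) ⟩
    ∏ p (λ j → at.evalMap k Fᶜ (at k (ℤ[T][X].pow T j) * x))         ≈⟨ ∏-cong p (λ j → trans (evalMap-Fᶜ F _) (F-cong (*-congʳ (at-Tʲ j)))) ⟩
    ∏ p (λ j → F[ pow (pow ω k) j * x ])                             ∎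
    where
    T : ℤPoly
    T = ℤP.X
    Fᶜ : ℤ[T][X]
    Fᶜ = map ℤP.const F
    evalMap-Fᶜ : ∀ G y → at.evalMap k (map ℤP.const G) y ≈ evalMap G y
    evalMap-Fᶜ []      y = refl
    evalMap-Fᶜ (a ∷ G) y = +-cong (ι.evalMap-const ι-isRingHom a (pow ω k)) (*-congˡ (evalMap-Fᶜ G y))
    at-Tʲ : ∀ j → at k (ℤ[T][X].pow T j) ≈ pow (pow ω k) j
    at-Tʲ j = trans (at.φ-pow k (at-isRingHom k) T j) (pow-cong j (ι.evalMap-X ι-isRingHom (pow ω k)))

  H : Poly
  H = prodₚ p (λ j → twist (pow ω j) (ιₚ F))

  eval-H : ∀ x → eval H x ≈ ∏ p (λ j → F[ pow ω j * x ])
  eval-H x = trans (eval-prodₚ p (λ j → twist (pow ω j) (ιₚ F)) x) (∏-cong p (λ j → eval-twist (pow ω j) (ιₚ F) x))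

  coeffAt : ℕ → ℕ → Carrier
  coeffAt k m = at k (ℤ[T][X].coeff genericH m)

  private
    eval-genericH-1 : ∀ x → at.evalMap 1 genericH x ≈ ∏ p (λ j → F[ pow ω j * x ])
    eval-genericH-1 x = trans (eval-genericH 1 x) (∏-cong p (λ j → F-cong (*-congʳ (pow-cong j (*-identityʳ ω)))))

    coeff-at : ∀ k m → coeff (map (at k) genericH) m ≈ coeffAt k m
    coeff-at k = at.coeff-map k (at-isRingHom k) genericH

  coeff-H : ∀ m → coeff H m ≈ coeffAt 1 m
  coeff-H m = trans (eval≈⇒≈ₚ H (map (at 1) genericH) (λ x → trans (eval-H x) (sym (eval-genericH-1 x))) m) (coeff-at 1 m)

  coeffAt-coprime : ∀ k → ¬ (p ℕ.∣ k) → ∀ m → coeffAt k m ≈ coeffAt 1 m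
  coeffAt-coprime k p∤k m = trans (sym (coeff-at k m)) (trans (eval≈⇒≈ₚ (map (at k) genericH) (map (at 1) genericH) same-eval m) (coeff-at 1 m))
    where
    same-eval : ∀ x → at.evalMap k genericH x ≈ at.evalMap 1 genericH x
    same-eval x = begin
      at.evalMap k genericH x                 ≈⟨ eval-genericH k x ⟩
      ∏ p (λ j → F[ pow (pow ω k) j * x ])    ≈⟨ ∏-cong p (λ j → F-cong (*-congʳ (trans (sym (pow-pow ω k j)) (reflexive (≡.cong (pow ω) (ℕ.*-comm j k)))))) ⟩
      ∏ p (λ j → F[ pow ω (k ℕ.* j) * x ])    ≈⟨ ∏-reindex-* (λ y → F[ y * x ]) (F-cong ∘ *-congʳ) k p∤k ⟩
      ∏ p (λ j → F[ pow ω j * x ])            ≈⟨ eval-genericH-1 x ⟨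
      at.evalMap 1 genericH x                 ∎

  -- H(ωx) = H(x), so ωᵐ hₘ = hₘ for every coefficient hₘ of H.
  coeffAt-1≈0 : ∀ m → ¬ (p ℕ.∣ m) → coeffAt 1 m ≈ 0#
  coeffAt-1≈0 m p∤m = *≈0⇒≈0 [ωᵐ-1]h≈0 (λ ωᵐ-1≈0 → pow≉1 m p∤m (x∙y⁻¹≈ε⇒x≈y _ _ ωᵐ-1≈0))
    where
    H₁ : Poly
    H₁ = map (at 1) genericH
    twist-invariant : twist ω H₁ ≈ₚ H₁
    twist-invariant = eval≈⇒≈ₚ (twist ω H₁) H₁ (λ x → begin
      eval (twist ω H₁) x                     ≈⟨ eval-twist ω H₁ x ⟩
      eval H₁ (ω * x)                         ≈⟨ eval-genericH-1 (ω * x) ⟩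
      ∏ p (λ j → F[ pow ω j * (ω * x) ])      ≈⟨ ∏-cong p (λ j → F-cong (trans (sym (*-assoc _ _ _)) (*-congʳ (*-comm _ _)))) ⟩
      ∏ p (λ j → F[ pow ω (suc j) * x ])      ≈⟨ ∏-reindex-suc (λ y → F[ y * x ]) (F-cong ∘ *-congʳ) ⟩
      ∏ p (λ j → F[ pow ω j * x ])            ≈⟨ eval-genericH-1 x ⟨
      eval H₁ x                               ∎)
    h : Carrier
    h = coeff H₁ m
    ωᵐh≈h : pow ω m * h ≈ h
    ωᵐh≈h = trans (sym (trans (coeff-twistFrom ω 1# H₁ m) (*-congʳ (*-identityˡ _)))) (twist-invariant m)
    [ωᵐ-1]h≈0 : (pow ω m - 1#) * coeffAt 1 m ≈ 0#
    [ωᵐ-1]h≈0 = begin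
      (pow ω m - 1#) * coeffAt 1 m       ≈⟨ *-congˡ (coeff-at 1 m) ⟨
      (pow ω m - 1#) * h                 ≈⟨ solve 3 (λ w o c → (w :- o) :* c := w :* c :- o :* c) refl (pow ω m) 1# h ⟩
      pow ω m * h - 1# * h               ≈⟨ +-cong ωᵐh≈h (-‿cong (*-identityˡ _)) ⟩
      h - h                              ≈⟨ -‿inverseʳ _ ⟩
      0#                                 ∎

  private
    ∑-orthogonality : ∀ w a (p∣?w : Dec (p ℕ.∣ w)) → ι a * ∑ p (λ k → pow ω (k ℕ.* w)) ≈ natCast p * ι (if does p∣?w then a else + 0)
    ∑-orthogonality w a (yes p∣w) = trans (*-congˡ (∑-root-multiple w p∣w)) (*-comm _ _)
    ∑-orthogonality w a (no p∤w)  = trans (*-congˡ (∑-root-nonmultiple w p∤w)) (trans (zeroʳ _) (sym (zeroʳ _)))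

  ∑-twisted-eval : ∀ c w → ∑ p (λ k → pow ω (k ℕ.* w) * evalMap c (pow ω k)) ≈ natCast p * ι (residueSum w c)
  ∑-twisted-eval []      w = trans (∑-cong p (λ k _ → zeroʳ _)) (trans (∑-0 p) (sym (zeroʳ _)))
  ∑-twisted-eval (a ∷ c) w = begin
    ∑ p (λ k → pow ω (k ℕ.* w) * (ι a + pow ω k * evalMap c (pow ω k)))
      ≈⟨ ∑-cong p (λ k _ → split k) ⟩
    ∑ p (λ k → ι a * pow ω (k ℕ.* w) + pow ω (k ℕ.* suc w) * evalMap c (pow ω k))
      ≈⟨ ∑-+ p _ _ ⟩
    ∑ p (λ k → ι a * pow ω (k ℕ.* w)) + ∑ p (λ k → pow ω (k ℕ.* suc w) * evalMap c (pow ω k))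
      ≈⟨ +-cong (trans (∑-*ˡ p (ι a) _) (∑-orthogonality w a (p ∣? w))) (∑-twisted-eval c (suc w)) ⟩
    natCast p * ι (if does (p ∣? w) then a else + 0) + natCast p * ι (residueSum (suc w) c)
      ≈⟨ trans (sym (distribˡ _ _ _)) (*-congˡ (sym (ι-+ (if does (p ∣? w) then a else + 0) (residueSum (suc w) c)))) ⟩
    natCast p * ι (residueSum w (a ∷ c)) ∎
    where
    split : ∀ k → pow ω (k ℕ.* w) * (ι a + pow ω k * evalMap c (pow ω k)) ≈ ι a * pow ω (k ℕ.* w) + pow ω (k ℕ.* suc w) * evalMap c (pow ω k)
    split k = begin
      pow ω (k ℕ.* w) * (ι a + pow ω k * e)               ≈⟨ solve 4 (λ W a K e → W :* (a :+ K :* e) := a :* W :+ (K :* W) :* e) refl (pow ω (k ℕ.* w)) (ι a) (pow ω k) e ⟩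
      ι a * pow ω (k ℕ.* w) + (pow ω k * pow ω (k ℕ.* w)) * e ≈⟨ +-congˡ (*-congʳ (sym (trans (reflexive (≡.cong (pow ω) (ℕ.*-suc k w))) (pow-+ ω k (k ℕ.* w))))) ⟩
      ι a * pow ω (k ℕ.* w) + pow ω (k ℕ.* suc w) * e     ∎
      where e = evalMap c (pow ω k)

  ∑-twisted-coeffAt : ∀ m w → ∑ p (λ k → pow ω (k ℕ.* w) * coeffAt k m) ≈ coeffAt 0 m + (∑ p (λ k → pow ω (k ℕ.* w)) - 1#) * coeffAt 1 m
  ∑-twisted-coeffAt m w = begin
    ∑ p (λ k → pow ω (k ℕ.* w) * coeffAt k m)                          ≈⟨ ∑-first (suc n) (λ k → pow ω (k ℕ.* w) * coeffAt k m) ⟩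
    1# * coeffAt 0 m + ∑ (suc n) (λ k → pow ω (suc k ℕ.* w) * coeffAt (suc k) m) ≈⟨ +-cong (*-identityˡ _) (∑-cong (suc n) coprime) ⟩
    coeffAt 0 m + ∑ (suc n) (λ k → pow ω (suc k ℕ.* w) * coeffAt 1 m)  ≈⟨ +-congˡ (∑-*ʳ (suc n) (coeffAt 1 m) (λ k → pow ω (suc k ℕ.* w))) ⟩
    coeffAt 0 m + S′ * coeffAt 1 m                                     ≈⟨ +-congˡ (*-congʳ S′≈S-1) ⟩
    coeffAt 0 m + (∑ p (λ k → pow ω (k ℕ.* w)) - 1#) * coeffAt 1 m     ∎
    where
    coprime : ∀ k → k < suc n → pow ω (suc k ℕ.* w) * coeffAt (suc k) m ≈ pow ω (suc k ℕ.* w) * coeffAt 1 m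
    coprime k k<n = *-congˡ (coeffAt-coprime (suc k) (>⇒∤ (s≤s k<n)) m)
    S′ : Carrier
    S′ = ∑ (suc n) (λ k → pow ω (suc k ℕ.* w))
    S′≈S-1 : S′ ≈ ∑ p (λ k → pow ω (k ℕ.* w)) - 1#
    S′≈S-1 = begin
      S′               ≈⟨ solve 2 (λ s o → s := (o :+ s) :- o) refl S′ 1# ⟩
      (1# + S′) - 1#   ≈⟨ +-congʳ (∑-first (suc n) (λ k → pow ω (k ℕ.* w))) ⟨
      ∑ p (λ k → pow ω (k ℕ.* w)) - 1# ∎

  private
    coefficientsOf : ℕ → ℤPoly
    coefficientsOf m = ℤ[T][X].coeff genericH m

    ∑-coeffAt : ∀ m w (S : Carrier) → ∑ p (λ k → pow ω (k ℕ.* w)) ≈ S →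
                coeffAt 0 m + (S - 1#) * coeffAt 1 m ≈ natCast p * ι (residueSum w (coefficientsOf m))
    ∑-coeffAt m w S ∑≈S = trans (+-congˡ (*-congʳ (+-congʳ (sym ∑≈S))))
                          (trans (sym (∑-twisted-coeffAt m w)) (∑-twisted-eval (coefficientsOf m) w))

  coeffAt-0 : ∀ m → coeffAt 0 m + (natCast p - 1#) * coeffAt 1 m ≈ natCast p * ι (residueSum 0 (coefficientsOf m))
  coeffAt-0 m = ∑-coeffAt m 0 (natCast p) (∑-root-multiple 0 (p ∣0))

  -- Subtracting the twisted sums for w = 0 and w = p - 1 isolates p · hₘ.
  ι-gCoeff : ∀ m → ι (gCoeff m) ≈ coeffAt 1 m
  ι-gCoeff m = sym (x∙y⁻¹≈ε⇒x≈y _ _ (*≈0⇒≈0 p[h-g]≈0 (natCast-suc≉0# (suc n))))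
    where
    c : ℤPoly
    c = coefficientsOf m
    A₀ A₁ s₀ s₁ : Carrier
    A₀ = coeffAt 0 m
    A₁ = coeffAt 1 m
    s₀ = ι (residueSum 0 c)
    s₁ = ι (residueSum (suc n) c)
    w=p-1 : A₀ + (0# - 1#) * A₁ ≈ natCast p * s₁
    w=p-1 = ∑-coeffAt m (suc n) 0# (∑-root-nonmultiple (suc n) (>⇒∤ ℕ.≤-refl))
    p[h-g]≈0 : natCast p * (A₁ - ι (gCoeff m)) ≈ 0#
    p[h-g]≈0 = begin
      natCast p * (A₁ - ι (gCoeff m))                   ≈⟨ *-congˡ (+-congˡ (-‿cong (trans (ι-+ (residueSum 0 c) _) (+-congˡ (ι-neg (residueSum (suc n) c)))))) ⟩
      natCast p * (A₁ - (s₀ + - s₁))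
        ≈⟨ solve 5 (λ N a₀ a₁ s₀ s₁ → N :* (a₁ :- (s₀ :+ :- s₁))
                    := ((a₀ :+ (N :- con (+ 1)) :* a₁) :- (a₀ :+ (con (+ 0) :- con (+ 1)) :* a₁)) :- (N :* s₀ :- N :* s₁))
                   refl (natCast p) A₀ A₁ s₀ s₁ ⟩
      ((A₀ + (natCast p - ι (+ 1)) * A₁) - (A₀ + (0# - ι (+ 1)) * A₁)) - (natCast p * s₀ - natCast p * s₁)
        ≈⟨ +-congʳ (+-cong (trans (+-congˡ (*-congʳ (+-congˡ (-‿cong ι-1)))) (coeffAt-0 m)) (-‿cong (trans (+-congˡ (*-congʳ (+-congˡ (-‿cong ι-1)))) w=p-1))) ⟩
      (natCast p * s₀ - natCast p * s₁) - (natCast p * s₀ - natCast p * s₁) ≈⟨ -‿inverseʳ _ ⟩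
      0#                                                ∎

  private
    coeff-g[xᵖ] : ∀ i → Dec (p ℕ.∣ i) → coeff H i ≈ coeff (ιₚ (ℤP.subPow p g)) i
    coeff-g[xᵖ] i (yes (divides q i≡qp)) = begin
      coeff H i                         ≈⟨ coeff-H i ⟩
      coeffAt 1 i                       ≈⟨ ι-gCoeff i ⟨
      ι (gCoeff i)                      ≡⟨ ≡.cong ι (≡.trans (≡.cong gCoeff i≡qp) (≡.sym (coeff-g q))) ⟩
      ι (ℤP.coeff g q)                  ≡⟨ ≡.cong ι (≡.trans (≡.sym (RingLemmas.coeff-subPow-* ℤring (suc n) g q)) (≡.cong (ℤP.coeff (ℤP.subPow p g)) (≡.sym i≡qp))) ⟩
      ι (ℤP.coeff (ℤP.subPow p g) i)    ≈⟨ ι.coeff-map ι-isRingHom (ℤP.subPow p g) i ⟨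
      coeff (ιₚ (ℤP.subPow p g)) i      ∎
    coeff-g[xᵖ] i (no p∤i) = begin
      coeff H i                         ≈⟨ trans (coeff-H i) (coeffAt-1≈0 i p∤i) ⟩
      ι (+ 0)                           ≡⟨ ≡.cong ι (RingLemmas.coeff-subPow-∤ ℤring (suc n) g i p∤i) ⟨
      ι (ℤP.coeff (ℤP.subPow p g) i)    ≈⟨ ι.coeff-map ι-isRingHom (ℤP.subPow p g) i ⟨
      coeff (ιₚ (ℤP.subPow p g)) i      ∎

  H≈g[xᵖ] : H ≈ₚ ιₚ (ℤP.subPow p g)
  H≈g[xᵖ] i = coeff-g[xᵖ] i (p ∣? i)

  eval-g : ∀ y → evalMap g (pow y p) ≈ ∏ p (λ j → F[ pow ω j * y ])
  eval-g y = begin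
    evalMap g (pow y p)                 ≈⟨ ι.evalMap-subPow ι-isRingHom (suc n) g y ⟨
    eval (ιₚ (ℤP.subPow p g)) y         ≈⟨ eval-cong H (ιₚ (ℤP.subPow p g)) y H≈g[xᵖ] ⟨
    eval H y                            ≈⟨ eval-H y ⟩
    ∏ p (λ j → F[ pow ω j * y ])        ∎

-- Reduction modulo p

module Congruence {r ℓ} (R : CommutativeRing r ℓ) (D : Cast.IsChar0Domain R)
  (n : ℕ) (pr : Prime (2 ℕ.+ n)) (ω : CommutativeRing.Carrier R)
  (prim : Cast.IsPrimitiveRoot R (2 ℕ.+ n) ω) (F : ℤPoly) where
  open CommutativeRing R
  open Cast R
  open IntCast R
  open Char0Domain R D using (ι-injective)
  open NormPolynomial n F
  open Construction R D n pr ω prim F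
  open PolyFrobenius n pr using (coeff-powₚ-p)
  private
    module ℤ[T][X] = PolyOps ℤ[X]
    module ι = EvalHom ℤring R ι
    module ℤ[X] = CommutativeRing ℤ[X]

  ε : ℤPoly → ℤ
  ε c = ℤP.eval c (+ 1)

  private
    module ε = EvalHom ℤ[X] ℤring ε
    open PolyOps ℤring
    open Eval ℤring
    open RingLemmas ℤring

  ε-isRingHom : ε.IsRingHom
  ε-isRingHom = record
    { φ-cong = λ {c} {d} → eval-cong c d (+ 1) ; φ-+ = λ c d → eval-⊕ c d (+ 1)
    ; φ-* = λ c d → eval-⊗ c d (+ 1) ; φ-0 = ≡.refl ; φ-1 = eval-const (+ 1) (+ 1) }

  ε-genericH : map ε genericH ≈ₚ powₚ F p
  ε-genericH = Char0Domain.eval≈⇒≈ₚ ℤring ℤ-isChar0Domain (map ε genericH) (powₚ F p) (λ x → begin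
      ε.evalMap genericH x                                         ≡⟨ ε.evalMap-prodₚ ε-isRingHom p (λ j → ℤ[T][X].twist (ℤ[T][X].pow X j) Fᶜ) x ⟩
      ∏ p (λ j → ε.evalMap (ℤ[T][X].twist (ℤ[T][X].pow X j) Fᶜ) x) ≡⟨ ∏-cong p (λ j → ε.evalMap-twist ε-isRingHom (ℤ[T][X].pow X j) Fᶜ x) ⟩
      ∏ p (λ j → ε.evalMap Fᶜ (ε (ℤ[T][X].pow X j) ℤ.* x))         ≡⟨ ∏-cong p (λ j → ≡.trans (evalMap-Fᶜ F _) (eval-arg F (ε-Tʲ j x))) ⟩
      ∏ p (λ j → eval F x)                                         ≡⟨ eval-prodₚ p (λ _ → F) x ⟨
      eval (prodₚ p (λ _ → F)) x                                   ≡⟨ ≡.cong (λ Q → eval Q x) (prodₚ-const p) ⟩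
      eval (powₚ F p) x                                            ∎)
    where
    open ≡.≡-Reasoning
    Fᶜ : ℤ[T][X]
    Fᶜ = map const F
    evalMap-Fᶜ : ∀ G y → ε.evalMap (map const G) y ≡ eval G y
    evalMap-Fᶜ []      y = ≡.refl
    evalMap-Fᶜ (a ∷ G) y = ≡.cong₂ ℤ._+_ (eval-const a (+ 1)) (≡.cong (y ℤ.*_) (evalMap-Fᶜ G y))
    ε-Tʲ : ∀ j x → ε (ℤ[T][X].pow X j) ℤ.* x ≡ x
    ε-Tʲ j x = ≡.trans (≡.cong (ℤ._* x) (≡.trans (ε.φ-pow ε-isRingHom X j) (≡.trans (pow-cong j (eval-X (+ 1))) (pow-1# j)))) (ℤ.*-identityˡ x)
    prodₚ-const : ∀ k → prodₚ k (λ _ → F) ≡ powₚ F k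
    prodₚ-const zero    = ≡.refl
    prodₚ-const (suc k) = ≡.cong (F ⊗_) (prodₚ-const k)

  private
    ι-eval : ∀ c z → ι (eval c z) ≈ evalMap c (ι z)
    ι-eval []      z = refl
    ι-eval (a ∷ c) z = trans (ι-+ a _) (+-congˡ (trans (ι-* z _) (*-congˡ (ι-eval c z))))

  ε≡gCoeff : ∀ m → ε (ℤ[T][X].coeff genericH m) ≡ gCoeff m [mod p ]
  ε≡gCoeff m = byMultiple (s ℤ.- γ) (rearrange e γ s (+ p) (ι-injective ι[e+[p-1]γ]≈ι[ps]))
    where
    open import Relation.Binary.Reasoning.Setoid setoid
    c : ℤPoly
    c = ℤ[T][X].coeff genericH m
    e γ s : ℤ
    e = ε c
    γ = gCoeff m
    s = residueSum 0 c
    ι[e+[p-1]γ]≈ι[ps] : ι (e ℤ.+ (+ p ℤ.- + 1) ℤ.* γ) ≈ ι (+ p ℤ.* s)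
    ι[e+[p-1]γ]≈ι[ps] = begin
      ι (e ℤ.+ (+ p ℤ.- + 1) ℤ.* γ)
        ≈⟨ trans (ι-+ e _) (+-congˡ (trans (ι-* (+ p ℤ.- + 1) γ) (*-congʳ (trans (ι-+ (+ p) (ℤ.- + 1)) (+-congˡ (trans (ι-neg (+ 1)) (-‿cong ι-1))))))) ⟩
      ι e + (natCast p - 1#) * ι γ                ≈⟨ +-cong (trans (ι-eval c (+ 1)) (RingLemmas.eval-arg R (ιₚ c) ι-1)) (*-congˡ (ι-gCoeff m)) ⟩
      coeffAt 0 m + (natCast p - 1#) * coeffAt 1 m ≈⟨ coeffAt-0 m ⟩
      natCast p * ι s                             ≈⟨ ι-* (+ p) s ⟨
      ι (+ p ℤ.* s)                               ∎
    rearrange : ∀ e γ s p → e ℤ.+ (p ℤ.- + 1) ℤ.* γ ≡ p ℤ.* s → e ≡ γ ℤ.+ p ℤ.* (s ℤ.- γ)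
    rearrange e γ s p eq = ≡.trans (split e γ p) (≡.trans (≡.cong (λ t → t ℤ.- p ℤ.* γ ℤ.+ γ) eq) (collect γ s p))
      where
      split : ∀ e γ p → e ≡ (e ℤ.+ (p ℤ.- + 1) ℤ.* γ) ℤ.- p ℤ.* γ ℤ.+ γ
      split = solve-∀
      collect : ∀ γ s p → p ℤ.* s ℤ.- p ℤ.* γ ℤ.+ γ ≡ γ ℤ.+ p ℤ.* (s ℤ.- γ)
      collect = solve-∀

  g≡F : ∀ i → coeff g i ≡ coeff F i [mod p ]
  g≡F i = ≡[mod]-trans (≡⇒≡[mod] (coeff-g i)) (≡[mod]-trans (≡[mod]-sym (ε≡gCoeff (i ℕ.* p)))
            (≡[mod]-trans (≡⇒≡[mod] (≡.trans (≡.sym (ε.coeff-map ε-isRingHom genericH (i ℕ.* p))) (ε-genericH (i ℕ.* p))))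
              (coeff-powₚ-p F i)))

-- Norms

module Norms {r ℓ} (R : CommutativeRing r ℓ) (D : Cast.IsChar0Domain R)
  (n : ℕ) (pr : Prime (2 ℕ.+ n)) (ωs : ℕ → CommutativeRing.Carrier R)
  (prims : ∀ k → 1 ≤ k → Cast.IsPrimitiveRoot R ((2 ℕ.+ n) ℕ.^ k) (ωs k)) (F : ℤPoly) where
  open CommutativeRing R
  open PolyOps R
  open Cast R
  open RingLemmas R
  open Char0Domain R D
  open IndexedProducts R
  open NormPolynomial n F using (p; g)
  open import Relation.Binary.Reasoning.Setoid setoid

  ω : Carrier
  ω = ωs 1

  primitive-ω : IsPrimitiveRoot p ω
  primitive-ω = ≡.subst (λ N → IsPrimitiveRoot N ω) (ℕ.^-identityʳ p) (prims 1 (s≤s z≤n))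

  open Construction R D n pr ω primitive-ω F

  F[1]*N₁≈g[1] : F[ 1# ] * N p ωs 1 F ≈ evalMap g 1#
  F[1]*N₁≈g[1] = begin
    F[ 1# ] * prodCoprime p (p ℕ.^ 1) (λ j → F[ pow ω j ]) ≡⟨ ≡.cong (λ k → F[ 1# ] * prodCoprime p k (λ j → F[ pow ω j ])) (ℕ.^-identityʳ p) ⟩
    F[ 1# ] * prodCoprime p p (λ j → F[ pow ω j ])         ≈⟨ *-congˡ (prodCoprime-self (suc n) (λ j → F[ pow ω j ])) ⟩
    F[ 1# ] * ∏ (suc n) (λ j → F[ pow ω (suc j) ])         ≈⟨ ∏-first (suc n) (λ j → F[ pow ω j ]) ⟨
    ∏ p (λ j → F[ pow ω j ])                               ≈⟨ ∏-cong p (λ j → F-cong (sym (*-identityʳ _))) ⟩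
    ∏ p (λ j → F[ pow ω j * 1# ])                          ≈⟨ eval-g 1# ⟨
    evalMap g (pow 1# p)                                   ≈⟨ eval-arg (ιₚ g) (pow-1# p) ⟩
    evalMap g 1#                                           ∎

  module _ (j : ℕ) where
    private
      M : ℕ
      M = p ℕ.^ suc j

      0<M : 0 < M
      0<M = ℕ.m^n>0 p (suc j)

      instance
        M≢0 : ℕ.NonZero M
        M≢0 = ℕ.>-nonZero 0<M

      ζ β ζᵖ α : Carrier
      ζ  = ωs (2 ℕ.+ j)
      β  = ωs (1 ℕ.+ j)
      ζᵖ = pow ζ p
      α  = pow ζ M

      primitive-ζ : IsPrimitiveRoot (p ℕ.* M) ζ
      primitive-ζ = prims (2 ℕ.+ j) (s≤s z≤n)

      primitive-β : IsPrimitiveRoot M β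
      primitive-β = prims (1 ℕ.+ j) (s≤s z≤n)

      primitive-ζᵖ : IsPrimitiveRoot M ζᵖ
      primitive-ζᵖ = primitive-pow p M ζ primitive-ζ (s≤s z≤n)

      primitive-α : IsPrimitiveRoot p α
      primitive-α = primitive-pow M p ζ (≡.subst (λ N → IsPrimitiveRoot N ζ) (ℕ.*-comm p M) primitive-ζ) 0<M

      β-as-ζᵖ : Σ ℕ (λ m → ¬ (p ℕ.∣ m) × β ≈ pow ζᵖ m)
      β-as-ζᵖ = primitive⇒pow-coprime pr (ℕ.m^n>0 p j) primitive-β primitive-ζᵖ
      ω-as-α : Σ ℕ (λ s → ¬ (p ℕ.∣ s) × ω ≈ pow α s)
      ω-as-α = primitive⇒pow-coprime {K = 1} pr (s≤s z≤n) (p*1 primitive-ω) (p*1 primitive-α)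
        where
        p*1 : ∀ {γ} → IsPrimitiveRoot p γ → IsPrimitiveRoot (p ℕ.* 1) γ
        p*1 {γ} = ≡.subst (λ N → IsPrimitiveRoot N γ) (≡.sym (ℕ.*-identityʳ p))

      ∏F[ω^l·y]≈∏F[α^l·y] : ∀ y → ∏ p (λ l → F[ pow ω l * y ]) ≈ ∏ p (λ l → F[ pow α l * y ])
      ∏F[ω^l·y]≈∏F[α^l·y] y = let s , p∤s , ω≈αˢ = ω-as-α in begin
        ∏ p (λ l → F[ pow ω l * y ])
          ≈⟨ ∏-cong p (λ l → F-cong (*-congʳ (trans (pow-cong l ω≈αˢ) (trans (sym (pow-pow α s l)) (reflexive (≡.cong (pow α) (ℕ.*-comm l s))))))) ⟩
        ∏ p (λ l → F[ pow α (s ℕ.* l) * y ])    ≈⟨ PrimeRootOfUnity.∏-reindex-* R D n pr α primitive-α (λ z → F[ z * y ]) (F-cong ∘ *-congʳ) s p∤s ⟩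
        ∏ p (λ l → F[ pow α l * y ])            ∎

      g[ζᵖᵘ] : ∀ u → evalMap g (pow ζᵖ u) ≈ ∏ p (λ l → F[ pow ζ (l ℕ.* M ℕ.+ u) ])
      g[ζᵖᵘ] u = begin
        evalMap g (pow ζᵖ u)                     ≈⟨ eval-arg (ιₚ g) (pow-comm ζ p u) ⟩
        evalMap g (pow (pow ζ u) p)              ≈⟨ eval-g (pow ζ u) ⟩
        ∏ p (λ l → F[ pow ω l * pow ζ u ])       ≈⟨ ∏F[ω^l·y]≈∏F[α^l·y] (pow ζ u) ⟩
        ∏ p (λ l → F[ pow α l * pow ζ u ])       ≈⟨ ∏-cong p (λ l → F-cong (trans (*-congʳ (sym (pow-pow ζ M l))) (sym (pow-+ ζ (l ℕ.* M) u)))) ⟩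
        ∏ p (λ l → F[ pow ζ (l ℕ.* M ℕ.+ u) ])   ∎

      g[βᵘ] : ∀ u → evalMap g (pow β u) ≈ evalMap g (pow ζᵖ ((proj₁ β-as-ζᵖ ℕ.* u) % M))
      g[βᵘ] u = let m , _ , β≈ζᵖᵐ = β-as-ζᵖ in eval-arg (ιₚ g) (begin
        pow β u                      ≈⟨ pow-cong u β≈ζᵖᵐ ⟩
        pow (pow ζᵖ m) u             ≈⟨ pow-pow ζᵖ m u ⟨
        pow ζᵖ (u ℕ.* m)             ≡⟨ ≡.cong (pow ζᵖ) (ℕ.*-comm u m) ⟩
        pow ζᵖ (m ℕ.* u)             ≈⟨ pow-% ζᵖ M (proj₁ primitive-ζᵖ) (m ℕ.* u) ⟩
        pow ζᵖ ((m ℕ.* u) % M)       ∎)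

    N-step : N p ωs (2 ℕ.+ j) F ≈ N p ωs (1 ℕ.+ j) g
    N-step = begin
      prodCoprime p (p ℕ.* M) (λ k → F[ pow ζ k ])                                ≈⟨ prodCoprime-blocks p M (m∣m*n (p ℕ.^ j)) p (λ k → F[ pow ζ k ]) ⟩
      ∏ p (λ l → prodCoprime p M (λ u → F[ pow ζ (l ℕ.* M ℕ.+ u) ]))              ≈⟨ ∏-cong p (λ l → prodCoprime≈∏[coprimesTo] p M (λ u → F[ pow ζ (l ℕ.* M ℕ.+ u) ])) ⟩
      ∏ p (λ l → ∏[ (λ u → F[ pow ζ (l ℕ.* M ℕ.+ u) ]) ] (coprimesTo p M))       ≈⟨ ∏-∏[]-comm p (λ l u → F[ pow ζ (l ℕ.* M ℕ.+ u) ]) (coprimesTo p M) ⟨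
      ∏[ (λ u → ∏ p (λ l → F[ pow ζ (l ℕ.* M ℕ.+ u) ])) ] (coprimesTo p M)       ≈⟨ ∏[]-cong (coprimesTo p M) (λ {u} _ → g[ζᵖᵘ] u) ⟨
      ∏[ (λ u → evalMap g (pow ζᵖ u)) ] (coprimesTo p M)                         ≈⟨ prodCoprime≈∏[coprimesTo] p M (λ u → evalMap g (pow ζᵖ u)) ⟨
      prodCoprime p M (λ u → evalMap g (pow ζᵖ u))
        ≈⟨ prodCoprime-reindex-* pr j (proj₁ β-as-ζᵖ) (proj₁ (proj₂ β-as-ζᵖ)) (λ u → evalMap g (pow ζᵖ u)) ⟨
      prodCoprime p M (λ u → evalMap g (pow ζᵖ ((proj₁ β-as-ζᵖ ℕ.* u) % M)))     ≈⟨ prodCoprime-cong p M g[βᵘ] ⟨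
      prodCoprime p M (λ u → evalMap g (pow β u))                                ∎

  N[F]≈N[g] : ∀ i → 2 ≤ i → N p ωs i F ≈ N p ωs (i ∸ 1) g
  N[F]≈N[g] (suc zero)    (s≤s ())
  N[F]≈N[g] (suc (suc j)) _ = N-step j

-- The case p = 3

module CubicNorm {r ℓ} (R : CommutativeRing r ℓ) where
  open CommutativeRing R
  open Cast R using (ι)
  open IntCast R
  open import Relation.Binary.Reasoning.Setoid setoid

  -- The defect of the identity is a multiple of 1 + w + w², because w³ - 1 = (w - 1)(1 + w + w²).
  cubic-norm : ∀ A u v w → ι (+ 1) + w + w * w ≈ 0# →
               (A + (w * w) * u + ((w * w) * (w * w)) * v) * ((A + w * u + (w * w) * v) * (A + u + v))
               ≈ A * (A * A) + u * (u * u) + v * (v * v) - ι (+ 3) * (A * (u * v))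
  cubic-norm A u v w s≈0 = begin
    (A + (w * w) * u + ((w * w) * (w * w)) * v) * ((A + w * u + (w * w) * v) * (A + u + v))
      ≈⟨ solve 4 (λ A u v w →
           (A :+ (w :* w) :* u :+ ((w :* w) :* (w :* w)) :* v) :* ((A :+ w :* u :+ (w :* w) :* v) :* (A :+ u :+ v))
           := A :* (A :* A) :+ u :* (u :* u) :+ v :* (v :* v) :- con (+ 3) :* (A :* (u :* v))
              :+ (con (+ 1) :+ w :+ w :* w) :* ((A :+ u :+ v) :*
                 (A :* u :+ A :* v :+ u :* v :+ (w :- con (+ 1)) :* (con (+ 1) :+ w :+ w :* w) :* (u :* v)
                  :+ (w :- con (+ 1)) :* (u :* u :+ (con (+ 2) :+ (w :- con (+ 1)) :* (con (+ 1) :+ w :+ w :* w)) :* (v :* v) :+ w :* (A :* v) :- u :* v))))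
           refl A u v w ⟩
    A * (A * A) + u * (u * u) + v * (v * v) - ι (+ 3) * (A * (u * v)) + (ι (+ 1) + w + w * w) * Q
      ≈⟨ +-congˡ (trans (*-congʳ s≈0) (zeroˡ Q)) ⟩
    A * (A * A) + u * (u * u) + v * (v * v) - ι (+ 3) * (A * (u * v)) + 0#
      ≈⟨ +-identityʳ _ ⟩
    A * (A * A) + u * (u * u) + v * (v * v) - ι (+ 3) * (A * (u * v)) ∎
    where
    s Q : Carrier
    s = ι (+ 1) + w + w * w
    Q = (A + u + v) * (A * u + A * v + u * v + (w - ι (+ 1)) * s * (u * v)
          + (w - ι (+ 1)) * (u * u + (ι (+ 2) + (w - ι (+ 1)) * s) * (v * v) + w * (A * v) - u * v))

threeSection : ℤPoly → ℤPoly → ℤPoly → ℤPoly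
threeSection f₀ f₁ f₂ = ℤP._⊕_ (ℤP._⊕_ (ℤP.subPow 3 f₀) (ℤP._⊗_ ℤP.X (ℤP.subPow 3 f₁))) (ℤP._⊗_ (ℤP.powₚ ℤP.X 2) (ℤP.subPow 3 f₂))

cubicNormForm : ℤPoly → ℤPoly → ℤPoly → ℤPoly
cubicNormForm f₀ f₁ f₂ = ℤP._⊕_ (ℤP._⊕_ (ℤP._⊕_ (ℤP.powₚ f₀ 3) (ℤP._⊗_ ℤP.X (ℤP.powₚ f₁ 3))) (ℤP._⊗_ (ℤP.powₚ ℤP.X 2) (ℤP.powₚ f₂ 3)))
                                 (ℤP.neg (ℤP.scale (+ 3) (ℤP._⊗_ ℤP.X (ℤP._⊗_ f₀ (ℤP._⊗_ f₁ f₂)))))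

module CubicCase {r ℓ} (R : CommutativeRing r ℓ) (D : Cast.IsChar0Domain R)
  (pr : Prime 3) (ω : CommutativeRing.Carrier R) (prim : Cast.IsPrimitiveRoot R 3 ω) (F f₀ f₁ f₂ : ℤPoly) where
  open CommutativeRing R
  open PolyOps R
  open Cast R
  open IntCast R
  open RingLemmas R
  open Char0Domain R D
  open CubicNorm R
  open NormPolynomial 1 F using (g)
  open Construction R D 1 pr ω prim F
  private
    module ι = EvalHom ℤring R ι
  open import Relation.Binary.Reasoning.Setoid setoid

  private
    hom : IsRingHom
    hom = ι-isRingHom

    cube : ∀ a → pow a 3 ≈ a * (a * a)
    cube a = *-congˡ (*-congˡ (*-identityʳ a))

    square : ∀ a → pow a 2 ≈ a * a
    square a = *-congˡ (*-identityʳ a)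

    evalMap-X² : ∀ y → evalMap (ℤP.powₚ ℤP.X 2) y ≈ y * y
    evalMap-X² y = trans (ι.evalMap-powₚ hom ℤP.X 2 y) (trans (pow-cong 2 (ι.evalMap-X hom y)) (square y))

    evalMap-threeSection : ∀ y → evalMap (threeSection f₀ f₁ f₂) y ≈ (evalMap f₀ (pow y 3) + y * evalMap f₁ (pow y 3)) + (y * y) * evalMap f₂ (pow y 3)
    evalMap-threeSection y = trans (ι.evalMap-⊕ hom (ℤP._⊕_ a₀ a₁) a₂ y) (+-cong
      (trans (ι.evalMap-⊕ hom a₀ a₁ y) (+-cong (ι.evalMap-subPow hom 2 f₀ y) (trans (ι.evalMap-⊗ hom ℤP.X (ℤP.subPow 3 f₁) y) (*-cong (ι.evalMap-X hom y) (ι.evalMap-subPow hom 2 f₁ y)))))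
      (trans (ι.evalMap-⊗ hom (ℤP.powₚ ℤP.X 2) (ℤP.subPow 3 f₂) y) (*-cong (evalMap-X² y) (ι.evalMap-subPow hom 2 f₂ y))))
      where
      a₀ a₁ a₂ : ℤPoly
      a₀ = ℤP.subPow 3 f₀
      a₁ = ℤP._⊗_ ℤP.X (ℤP.subPow 3 f₁)
      a₂ = ℤP._⊗_ (ℤP.powₚ ℤP.X 2) (ℤP.subPow 3 f₂)

    evalMap-cubicNormForm : ∀ z → let A = evalMap f₀ z ; B = evalMap f₁ z ; C = evalMap f₂ z in
      evalMap (cubicNormForm f₀ f₁ f₂) z ≈ ((A * (A * A) + z * (B * (B * B))) + (z * z) * (C * (C * C))) - ι (+ 3) * (z * (A * (B * C)))
    evalMap-cubicNormForm z = trans (ι.evalMap-⊕ hom (ℤP._⊕_ (ℤP._⊕_ b₀ b₁) b₂) (ℤP.neg (ℤP.scale (+ 3) b₃)) z) (+-cong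
      (trans (ι.evalMap-⊕ hom (ℤP._⊕_ b₀ b₁) b₂ z) (+-cong
        (trans (ι.evalMap-⊕ hom b₀ b₁ z) (+-cong (trans (ι.evalMap-powₚ hom f₀ 3 z) (cube _))
                                                 (trans (ι.evalMap-⊗ hom ℤP.X (ℤP.powₚ f₁ 3) z) (*-cong (ι.evalMap-X hom z) (trans (ι.evalMap-powₚ hom f₁ 3 z) (cube _))))))
        (trans (ι.evalMap-⊗ hom (ℤP.powₚ ℤP.X 2) (ℤP.powₚ f₂ 3) z) (*-cong (evalMap-X² z) (trans (ι.evalMap-powₚ hom f₂ 3 z) (cube _))))))
      (trans (ι.evalMap-neg hom (ℤP.scale (+ 3) b₃) z) (-‿cong (trans (ι.evalMap-scale hom (+ 3) b₃ z)
        (*-congˡ (trans (ι.evalMap-⊗ hom ℤP.X (ℤP._⊗_ f₀ (ℤP._⊗_ f₁ f₂)) z) (*-cong (ι.evalMap-X hom z)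
          (trans (ι.evalMap-⊗ hom f₀ (ℤP._⊗_ f₁ f₂) z) (*-congˡ (ι.evalMap-⊗ hom f₁ f₂ z))))))))))
      where
      b₀ b₁ b₂ b₃ : ℤPoly
      b₀ = ℤP.powₚ f₀ 3
      b₁ = ℤP._⊗_ ℤP.X (ℤP.powₚ f₁ 3)
      b₂ = ℤP._⊗_ (ℤP.powₚ ℤP.X 2) (ℤP.powₚ f₂ 3)
      b₃ = ℤP._⊗_ ℤP.X (ℤP._⊗_ f₀ (ℤP._⊗_ f₁ f₂))

    1+ω+ω²≈0 : ι (+ 1) + ω + ω * ω ≈ 0#
    1+ω+ω²≈0 = begin
      ι (+ 1) + ω + ω * ω                   ≈⟨ +-congʳ (+-congʳ ι-1) ⟩
      1# + ω + ω * ω                        ≈⟨ solve 2 (λ o w → o :+ w :+ w :* w := w :* w :+ (w :+ o)) refl 1# ω ⟩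
      ω * ω + (ω + 1#)                      ≈⟨ +-cong (square ω) (+-cong (*-identityʳ ω) (+-identityʳ 1#)) ⟨
      ∑ 3 (λ k → pow ω (k ℕ.* 1))           ≈⟨ PrimeRootOfUnity.∑-root-nonmultiple R D 1 pr ω prim 1 (>⇒∤ (s≤s (s≤s z≤n))) ⟩
      0#                                    ∎

  module _ (F≈threeSection : F ℤP.≈ₚ threeSection f₀ f₁ f₂) where
    private
      F[ωʲx] : ∀ j x → let A = evalMap f₀ (pow x 3) ; u = x * evalMap f₁ (pow x 3) ; v = (x * x) * evalMap f₂ (pow x 3) in
               F[ pow ω j * x ] ≈ A + pow ω j * u + (pow ω j * pow ω j) * v
      F[ωʲx] j x = begin
        F[ y ]                                                           ≈⟨ ι.evalMap-cong hom {F} {threeSection f₀ f₁ f₂} y F≈threeSection ⟩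
        evalMap (threeSection f₀ f₁ f₂) y                                                ≈⟨ evalMap-threeSection y ⟩
        (evalMap f₀ (pow y 3) + y * evalMap f₁ (pow y 3)) + (y * y) * evalMap f₂ (pow y 3)
          ≈⟨ +-cong (+-congˡ (*-congˡ (eval-arg (ιₚ f₁) y³≈x³))) (*-congˡ (eval-arg (ιₚ f₂) y³≈x³)) ⟩
        (evalMap f₀ (pow y 3) + y * B) + (y * y) * C                     ≈⟨ +-congʳ (+-congʳ (eval-arg (ιₚ f₀) y³≈x³)) ⟩
        (A + y * B) + (y * y) * C
          ≈⟨ solve 5 (λ A W x B C → (A :+ (W :* x) :* B) :+ ((W :* x) :* (W :* x)) :* C := (A :+ W :* (x :* B)) :+ (W :* W) :* ((x :* x) :* C)) refl A (pow ω j) x B C ⟩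
        A + pow ω j * (x * B) + (pow ω j * pow ω j) * ((x * x) * C)      ∎
        where
        y A B C : Carrier
        y = pow ω j * x
        A = evalMap f₀ (pow x 3)
        B = evalMap f₁ (pow x 3)
        C = evalMap f₂ (pow x 3)
        y³≈x³ : pow y 3 ≈ pow x 3
        y³≈x³ = trans (pow-* (pow ω j) x 3) (trans (*-congʳ (trans (pow-comm ω j 3) (trans (pow-cong j (proj₁ prim)) (pow-1# j)))) (*-identityˡ _))

      eval-H≈cubicNormForm[x³] : ∀ x → eval H x ≈ eval (ιₚ (ℤP.subPow 3 (cubicNormForm f₀ f₁ f₂))) x
      eval-H≈cubicNormForm[x³] x = begin
        eval H x                                                        ≈⟨ eval-H x ⟩
        F[ pow ω 2 * x ] * (F[ pow ω 1 * x ] * (F[ pow ω 0 * x ] * 1#))  ≈⟨ *-cong (F[ωʲx] 2 x) (*-cong (F[ωʲx] 1 x) (*-identityʳ _)) ⟩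
        (A + pow ω 2 * u + (pow ω 2 * pow ω 2) * v) * ((A + pow ω 1 * u + (pow ω 1 * pow ω 1) * v) * F[ 1# * x ])
          ≈⟨ *-cong (+-cong (+-congˡ (*-congʳ (square ω))) (*-congʳ (*-cong (square ω) (square ω))))
                    (*-cong (+-cong (+-congˡ (*-congʳ (*-identityʳ ω))) (*-congʳ (*-cong (*-identityʳ ω) (*-identityʳ ω))))
                            (trans (F[ωʲx] 0 x) (+-cong (+-congˡ (*-identityˡ u)) (trans (*-congʳ (*-identityˡ 1#)) (*-identityˡ v))))) ⟩
        (A + (ω * ω) * u + ((ω * ω) * (ω * ω)) * v) * ((A + ω * u + (ω * ω) * v) * (A + u + v))
          ≈⟨ cubic-norm A u v ω 1+ω+ω²≈0 ⟩
        A * (A * A) + u * (u * u) + v * (v * v) - ι (+ 3) * (A * (u * v))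
          ≈⟨ solve 4 (λ A x B C →
               A :* (A :* A) :+ (x :* B) :* ((x :* B) :* (x :* B)) :+ ((x :* x) :* C) :* (((x :* x) :* C) :* ((x :* x) :* C))
                 :- con (+ 3) :* (A :* ((x :* B) :* ((x :* x) :* C)))
               := ((A :* (A :* A) :+ (x :* (x :* x)) :* (B :* (B :* B))) :+ ((x :* (x :* x)) :* (x :* (x :* x))) :* (C :* (C :* C)))
                 :- con (+ 3) :* ((x :* (x :* x)) :* (A :* (B :* C))))
               refl A x B C ⟩
        ((A * (A * A) + (x * (x * x)) * (B * (B * B))) + ((x * (x * x)) * (x * (x * x))) * (C * (C * C))) - ι (+ 3) * ((x * (x * x)) * (A * (B * C)))
          ≈⟨ +-cong (+-cong (+-congˡ (*-congʳ (cube x))) (*-congʳ (*-cong (cube x) (cube x)))) (-‿cong (*-congˡ (*-congʳ (cube x)))) ⟨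
        ((A * (A * A) + pow x 3 * (B * (B * B))) + (pow x 3 * pow x 3) * (C * (C * C))) - ι (+ 3) * (pow x 3 * (A * (B * C)))
          ≈⟨ evalMap-cubicNormForm (pow x 3) ⟨
        evalMap (cubicNormForm f₀ f₁ f₂) (pow x 3)                      ≈⟨ ι.evalMap-subPow hom 2 (cubicNormForm f₀ f₁ f₂) x ⟨
        eval (ιₚ (ℤP.subPow 3 (cubicNormForm f₀ f₁ f₂))) x               ∎
        where
        A B C u v : Carrier
        A = evalMap f₀ (pow x 3)
        B = evalMap f₁ (pow x 3)
        C = evalMap f₂ (pow x 3)
        u = x * B
        v = (x * x) * C

    g≈cubicNormForm : g ℤP.≈ₚ cubicNormForm f₀ f₁ f₂
    g≈cubicNormForm i = ι-injective (begin
      ι (ℤP.coeff g i)                                 ≡⟨ ≡.cong ι (RingLemmas.coeff-subPow-* ℤring 2 g i) ⟨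
      ι (ℤP.coeff (ℤP.subPow 3 g) (i ℕ.* 3))           ≈⟨ ι.coeff-map hom (ℤP.subPow 3 g) (i ℕ.* 3) ⟨
      coeff (ιₚ (ℤP.subPow 3 g)) (i ℕ.* 3)             ≈⟨ H≈g[xᵖ] (i ℕ.* 3) ⟨
      coeff H (i ℕ.* 3)                                ≈⟨ eval≈⇒≈ₚ H (ιₚ (ℤP.subPow 3 (cubicNormForm f₀ f₁ f₂))) eval-H≈cubicNormForm[x³] (i ℕ.* 3) ⟩
      coeff (ιₚ (ℤP.subPow 3 (cubicNormForm f₀ f₁ f₂))) (i ℕ.* 3)     ≈⟨ ι.coeff-map hom (ℤP.subPow 3 (cubicNormForm f₀ f₁ f₂)) (i ℕ.* 3) ⟩
      ι (ℤP.coeff (ℤP.subPow 3 (cubicNormForm f₀ f₁ f₂)) (i ℕ.* 3))   ≡⟨ ≡.cong ι (RingLemmas.coeff-subPow-* ℤring 2 (cubicNormForm f₀ f₁ f₂) i) ⟩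
      ι (ℤP.coeff (cubicNormForm f₀ f₁ f₂) i)                         ∎)

open import Data.Nat using (_^_)
open import Data.Integer using (_-_)

lemma2p4 : ∀ {c ℓ} (R : CommutativeRing c ℓ) →
    Cast.IsChar0Domain R →
    (p : ℕ) → Prime p →
    (ω : ℕ → CommutativeRing.Carrier R) →
    (∀ k → 1 ≤ k → Cast.IsPrimitiveRoot R (p ^ k) (ω k)) →
    (F : ℤPoly) →
    Σ ℤPoly (λ g →
      -- H(x) = ∏_{j=0}^{p-1} F(x ω_1^j) equals g(x^p) in R[x]
      PolyOps._≈ₚ_ R
        (PolyOps.prodₚ R p (λ j → PolyOps.twist R (PolyOps.pow R (ω 1) j) (Cast.ιₚ R F)))
        (Cast.ιₚ R (ℤP.subPow p g))
      -- g ≡ F (mod p) coefficientwise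
      × (∀ i → (+ p) ∣ (ℤP.coeff g i - ℤP.coeff F i))
      -- N_i(F) = N_{i-1}(g) for all i ≥ 2
      × (∀ i → 2 ≤ i → CommutativeRing._≈_ R (Cast.N R p ω i F) (Cast.N R p ω (i ∸ 1) g))
      -- F(1) N_1(F) = g(1)
      × CommutativeRing._≈_ R
          (CommutativeRing._*_ R (PolyOps.eval R (Cast.ιₚ R F) (CommutativeRing.1# R))
                                 (Cast.N R p ω 1 F))
          (PolyOps.eval R (Cast.ιₚ R g) (CommutativeRing.1# R))
      -- the case p = 3
      × (p ≡ 3 → (f₀ f₁ f₂ : ℤPoly) →
           ℤP._≈ₚ_ F (ℤP._⊕_ (ℤP._⊕_ (ℤP.subPow 3 f₀) (ℤP._⊗_ ℤP.X (ℤP.subPow 3 f₁)))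
                             (ℤP._⊗_ (ℤP.powₚ ℤP.X 2) (ℤP.subPow 3 f₂))) →
           ℤP._≈ₚ_ g (ℤP._⊕_ (ℤP._⊕_ (ℤP._⊕_ (ℤP.powₚ f₀ 3) (ℤP._⊗_ ℤP.X (ℤP.powₚ f₁ 3)))
                                     (ℤP._⊗_ (ℤP.powₚ ℤP.X 2) (ℤP.powₚ f₂ 3)))
                             (ℤP.neg (ℤP.scale (+ 3) (ℤP._⊗_ ℤP.X (ℤP._⊗_ f₀ (ℤP._⊗_ f₁ f₂))))))))
lemma2p4 _ _ 0 pr _ _ _ = ⊥-elim (¬prime[0] pr)
lemma2p4 _ _ 1 pr _ _ _ = ⊥-elim (¬prime[1] pr)
lemma2p4 R D (suc (suc n)) pr ω prims F =
  g , H≈g[xᵖ] , (λ i → ≡[mod]⇒∣- (g≡F i)) , N[F]≈N[g] , F[1]*N₁≈g[1] , cubic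
  where
  open NormPolynomial n F using (g)
  open Norms R D n pr ω prims F using (primitive-ω; N[F]≈N[g]; F[1]*N₁≈g[1])
  open Construction R D n pr (ω 1) primitive-ω F using (H≈g[xᵖ])
  open Congruence R D n pr (ω 1) primitive-ω F using (g≡F)
  cubic : suc (suc n) ≡ 3 → ∀ f₀ f₁ f₂ → F ℤP.≈ₚ threeSection f₀ f₁ f₂ → g ℤP.≈ₚ cubicNormForm f₀ f₁ f₂
  cubic ≡.refl = CubicCase.g≈cubicNormForm R D pr (ω 1) primitive-ω F
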